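{- Let $G$ be a finite abelian group, $R=\mathbb{Z}_p[G]$, and let $g_1,\dots,g_r\in G$ be such that the subgroup they generate is the internal direct product $\langle g_1\rangle\times\cdots\times\langle g_r\rangle$. Put $\beta_i=g_i-1$ and $\alpha_i=\sum_{k=1}^{\mathrm{ord}(g_i)}g_i^k$. For $1\le k\le r$ let $K_k=\{(y_1,\dots,y_k)\in R^k:\sum_{i=1}^ky_i\beta_i=0\}$ and let $e_1^k,\dots,e_k^k$ be the standard basis of $R^k$. Then $K_k$ is generated as an $R$-module by $$\{\alpha_ie_i^k:1\le i\le k\}\cup\{ -\beta_je_i^k+\beta_ie_j^k:1\le i<j\le k\}.$$ -}

module Defs where

open import Level using (0ℓ)
open import Data.Nat as ℕ using (ℕ; zero; suc)
open import Data.Integer as ℤ using (ℤ; +_; _-_)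
open import Data.Integer.Divisibility.Signed
  using (_∣_; ∣m∣n⇒∣m+n; ∣m⇒∣-m; ∣n⇒∣m*n; ∣m⇒∣m*n; ∣-refl)
import Data.Integer.Properties as ℤP
open import Data.Integer.Tactic.RingSolver using (solve-∀)
open import Data.Fin as Fin using (Fin; toℕ)
open import Data.Bool using (Bool; true; false; if_then_else_)
open import Data.Product using (_×_; Σ; ∃; ∃-syntax)
open import Data.Sum using (_⊎_)
open import Relation.Nullary using (¬_; does)
open import Relation.Binary.PropositionalEquality using (_≡_; _≢_; refl; subst)
open import Algebra.Structures using (IsAbelianGroup)
open import Function.Bundles using (_↔_; Inverse)

-- The ring ℤₚ of p-adic integers, as the inverse limit of the ℤ/pⁿℤ:
-- a p-adic integer is a sequence (aₙ) of integers with
-- aₙ₊₁ ≡ aₙ (mod pⁿ), where aₙ represents a class modulo pⁿ.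

_≡[mod_]_ : ℤ → ℤ → ℤ → Set
a ≡[mod m ] b = m ∣ (a - b)

record ℤₚ (p : ℕ) : Set where
  constructor mkℤₚ
  field
    seq : ℕ → ℤ
    coh : ∀ n → seq (suc n) ≡[mod + (p ℕ.^ n) ] seq n
open ℤₚ public

module _ {p : ℕ} where

  infix 4 _≈ₚ_
  _≈ₚ_ : ℤₚ p → ℤₚ p → Set
  a ≈ₚ b = ∀ n → seq a n ≡[mod + (p ℕ.^ n) ] seq b n

  private
    +-lem : ∀ a' a b' b → (a' ℤ.+ b') - (a ℤ.+ b) ≡ (a' - a) ℤ.+ (b' - b)
    +-lem = solve-∀
    *-lem : ∀ a' a b' b → (a' ℤ.* b') - (a ℤ.* b) ≡ a' ℤ.* (b' - b) ℤ.+ (a' - a) ℤ.* b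
    *-lem = solve-∀
    neg-lem : ∀ a' a → (ℤ.- a') - (ℤ.- a) ≡ ℤ.- (a' - a)
    neg-lem = solve-∀
    const-lem : ∀ c → c - c ≡ + 0
    const-lem = solve-∀

  constₚ : ℤ → ℤₚ p
  constₚ c = mkℤₚ (λ _ → c) (λ n → subst (_ ∣_) (ℤP.+-inverseʳ c ⟨sym⟩) (zero∣ n))
    where
      open import Relation.Binary.PropositionalEquality using (sym)
      _⟨sym⟩ : ∀ {x y : ℤ} → x ≡ y → y ≡ x
      e ⟨sym⟩ = sym e
      zero∣ : ∀ n → + (p ℕ.^ n) ∣ + 0
      zero∣ n = subst (+ (p ℕ.^ n) ∣_) (ℤP.*-zeroˡ (+ (p ℕ.^ n))) (∣n⇒∣m*n (+ 0) ∣-refl)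

  0ₚ 1ₚ : ℤₚ p
  0ₚ = constₚ (+ 0)
  1ₚ = constₚ (+ 1)

  infixl 6 _+ₚ_
  infixl 7 _*ₚ_
  _+ₚ_ : ℤₚ p → ℤₚ p → ℤₚ p
  a +ₚ b = mkℤₚ (λ n → seq a n ℤ.+ seq b n)
    (λ n → subst (_ ∣_) (sym' (+-lem (seq a (suc n)) (seq a n) (seq b (suc n)) (seq b n)))
                  (∣m∣n⇒∣m+n (coh a n) (coh b n)))
    where
      open import Relation.Binary.PropositionalEquality using () renaming (sym to sym')

  -ₚ_ : ℤₚ p → ℤₚ p
  -ₚ a = mkℤₚ (λ n → ℤ.- seq a n)
    (λ n → subst (_ ∣_) (sym' (neg-lem (seq a (suc n)) (seq a n))) (∣m⇒∣-m (coh a n)))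
    where
      open import Relation.Binary.PropositionalEquality using () renaming (sym to sym')

  _*ₚ_ : ℤₚ p → ℤₚ p → ℤₚ p
  a *ₚ b = mkℤₚ (λ n → seq a n ℤ.* seq b n)
    (λ n → subst (_ ∣_) (sym' (*-lem (seq a (suc n)) (seq a n) (seq b (suc n)) (seq b n)))
                  (∣m∣n⇒∣m+n (∣n⇒∣m*n (seq a (suc n)) (coh b n))
                             (∣m⇒∣m*n (seq b n) (coh a n))))
    where
      open import Relation.Binary.PropositionalEquality using () renaming (sym to sym')

record FinAbGroup : Set₁ where
  infixl 7 _∙_
  field
    Carrier        : Set
    _∙_            : Carrier → Carrier → Carrier
    ε              : Carrier
    _⁻¹            : Carrier → Carrier
    isAbelianGroup : IsAbelianGroup _≡_ _∙_ ε _⁻¹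
    size           : ℕ
    enum           : Fin size ↔ Carrier

module GroupNotions (G : FinAbGroup) where
  open FinAbGroup G

  _^_ : Carrier → ℕ → Carrier
  g ^ zero  = ε
  g ^ suc k = g ∙ (g ^ k)

  IsOrder : Carrier → ℕ → Set
  IsOrder g m = (0 ℕ.< m) × (g ^ m ≡ ε) × (∀ k → 0 ℕ.< k → k ℕ.< m → g ^ k ≢ ε)

  ∏ : ∀ {r} → (Fin r → Carrier) → Carrier
  ∏ {zero}  f = ε
  ∏ {suc r} f = f Fin.zero ∙ ∏ (λ i → f (Fin.suc i))

  -- The subgroup generated by g₁,…,g_r is the internal direct product
  -- ⟨g₁⟩ × ⋯ × ⟨g_r⟩, i.e. the multiplication map
  -- ⟨g₁⟩ × ⋯ × ⟨g_r⟩ → G, (x₁,…,x_r) ↦ x₁⋯x_r, is injective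
  -- (elements of ⟨gᵢ⟩ written as gᵢ^aᵢ, aᵢ ∈ ℕ, as G is finite).
  IsInternalDirectProduct : ∀ {r} → (Fin r → Carrier) → Set
  IsInternalDirectProduct {r} g =
    ∀ (a b : Fin r → ℕ) →
      ∏ (λ i → g i ^ a i) ≡ ∏ (λ i → g i ^ b i) →
      ∀ i → g i ^ a i ≡ g i ^ b i

-- The group ring R = ℤₚ[G], elements are functions G → ℤₚ
-- (G is finite, so every such function has finite support).

module GroupRing (p : ℕ) (G : FinAbGroup) where
  open FinAbGroup G
  open Inverse enum using (to; from)

  Σℤₚ : ∀ {n} → (Fin n → ℤₚ p) → ℤₚ p
  Σℤₚ {zero}  f = 0ₚ
  Σℤₚ {suc n} f = f Fin.zero +ₚ Σℤₚ (λ i → f (Fin.suc i))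

  R : Set
  R = Carrier → ℤₚ p

  infix 4 _≈R_
  _≈R_ : R → R → Set
  x ≈R y = ∀ h → x h ≈ₚ y h

  0R 1R : R
  0R _ = 0ₚ
  1R h = if does (from h Fin.≟ from ε) then 1ₚ else 0ₚ

  infixl 6 _+R_
  infixl 7 _*R_
  _+R_ : R → R → R
  (x +R y) h = x h +ₚ y h

  -R_ : R → R
  (-R x) h = -ₚ x h

  _*R_ : R → R → R
  (x *R y) h = Σℤₚ (λ i → x (to i) *ₚ y ((to i ⁻¹) ∙ h))

  ⟦_⟧ : Carrier → R
  ⟦ g ⟧ h = if does (from h Fin.≟ from g) then 1ₚ else 0ₚ

  ΣR : ∀ {n} → (Fin n → R) → R
  ΣR {zero}  f = 0R
  ΣR {suc n} f = f Fin.zero +R ΣR (λ i → f (Fin.suc i))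

  open GroupNotions G using (_^_)

  β : Carrier → R
  β g = ⟦ g ⟧ +R (-R 1R)

  -- α = Σ_{k=1}^{ord g} g^k   (m stands for ord g)
  α : Carrier → ℕ → R
  α g m = ΣR {m} (λ k → ⟦ g ^ suc (toℕ k) ⟧)

  Vecᴿ : ℕ → Set
  Vecᴿ k = Fin k → R

  infix 4 _≈V_
  _≈V_ : ∀ {k} → Vecᴿ k → Vecᴿ k → Set
  u ≈V v = ∀ i → u i ≈R v i

  0V : ∀ {k} → Vecᴿ k
  0V _ = 0R

  _+V_ : ∀ {k} → Vecᴿ k → Vecᴿ k → Vecᴿ k
  (u +V v) i = u i +R v i

  _·V_ : ∀ {k} → R → Vecᴿ k → Vecᴿ k
  (c ·V v) i = c *R v i

  ΣV : ∀ {k n} → (Fin n → Vecᴿ k) → Vecᴿ k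
  ΣV {n = zero}  f = 0V
  ΣV {n = suc n} f = f Fin.zero +V ΣV (λ i → f (Fin.suc i))

  e : ∀ {k} → Fin k → Vecᴿ k
  e i j = if does (i Fin.≟ j) then 1R else 0R

  Kernel : ∀ {k} → (Fin k → Carrier) → Vecᴿ k → Set
  Kernel g y = ΣR (λ i → y i *R β (g i)) ≈R 0R

  InSpan : ∀ {k} → (Vecᴿ k → Set) → Vecᴿ k → Set
  InSpan {k} S y =
    ∃[ n ] Σ (Fin n → Vecᴿ k) λ v → Σ (Fin n → R) λ c →
      (∀ j → S (v j)) × (y ≈V ΣV (λ j → c j ·V v j))

  GeneratedBy : ∀ {k} → (Vecᴿ k → Set) → (Vecᴿ k → Set) → Set
  GeneratedBy P S = (∀ v → S v → P v) × (∀ y → P y → InSpan S y)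

  Generators : ∀ {k} → (Fin k → Carrier) → (Fin k → ℕ) → Vecᴿ k → Set
  Generators g m v =
    (∃[ i ] v ≈V (α (g i) (m i) ·V e i))
    ⊎ (∃[ i ] ∃[ j ] (i Fin.< j) × (v ≈V (((-R β (g j)) ·V e i) +V (β (g i) ·V e j))))

{-# OPTIONS --safe #-}
module Submission where

-- Right multiplication by βᵢ = gᵢ − 1 is the difference operator ∂ᵢ x (h) = x (h gᵢ⁻¹) − x h and
-- right multiplication by αᵢ is the orbit sum Nᵢ along ⟨gᵢ⟩; a kernel element of ∂ᵢ is gᵢ-invariant
-- and hence a multiple of αᵢ.  Choosing the least element of every coset of H = ⟨g₁,…,g_r⟩ gives each
-- h ∈ G coordinates tᵢ(h) ∈ [0, ord gᵢ) which h ↦ h gⱼ⁻¹ shifts cyclically in the j-th place only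
-- (this is where the direct product is used).  Then Φᵢ x = [tᵢ = ord gᵢ − 1] · Nᵢ x is additive,
-- kills the image of ∂ᵢ, commutes with ∂ⱼ for j ≠ i, and x − Φᵢ x lies in the image of ∂ᵢ.
-- For y in the kernel, let Ψ be the composite of Φ₂,…,Φ_k, so y₁ = Σ_{i≥2} ∂ᵢ uᵢ + Ψ y₁ and
-- ∂₁ (Ψ y₁) = Ψ (∂₁ y₁) = − Σ_{i≥2} Ψ (∂ᵢ yᵢ) = 0.  So Ψ y₁ = c α₁, and subtracting c α₁ e₁ and the
-- Koszul relations −βᵢ e₁ + β₁ eᵢ with coefficients −uᵢ leaves a kernel element supported on
-- coordinates 2,…,k; induction on k concludes.  The argument works over any commutative ring.

open import Level using (0ℓ; _⊔_)
open import Function using (_∘_; Inverse)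
open import Data.Empty using (⊥-elim)
open import Data.Bool using (Bool; true; false; if_then_else_; T)
open import Data.Product using (Σ; ∃-syntax; _×_; _,_; proj₁; proj₂)
open import Data.Sum using (_⊎_; inj₁; inj₂)
open import Data.Nat as ℕ using (ℕ; zero; suc; _∸_; _<_; _≤_; _⊓_; z≤n; s≤s; pred; NonZero; >-nonZero)
import Data.Nat.Properties as ℕ
open import Data.Nat.DivMod using (_%_; _/_; m≡m%n+[m/n]*n; m%n<n; m<n⇒m%n≡m; n%n≡0)
open import Data.Nat.Primality using (Prime)
open import Data.Integer as ℤ using (ℤ; +_)
import Data.Integer.Properties as ℤ
open import Data.Integer.Divisibility.Signed using (_∣_; divides; ∣m∣n⇒∣m+n; ∣m⇒∣-m; ∣n⇒∣m*n; ∣m⇒∣m*n)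
open import Data.Integer.Tactic.RingSolver using (solve-∀)
open import Data.Fin as Fin using (Fin; toℕ; inject≤)
import Data.Fin.Properties as Fin
open import Data.Vec.Functional as Vector using (updateAt; removeAt; _++_; _∷_)
open import Data.Vec.Functional.Properties using (updateAt-updates; updateAt-minimal)
open import Relation.Nullary using (does; yes; no)
open import Relation.Binary.Definitions using (tri<; tri≈; tri>)
open import Relation.Binary.PropositionalEquality as ≡ using (_≡_; _≢_; module ≡-Reasoning)
open import Algebra.Bundles using (AbelianGroup; CommutativeRing)
open import Algebra.Structures using (IsCommutativeRing)
import Algebra.Properties.Group as GroupProperties
import Algebra.Properties.AbelianGroup as AbelianGroupProperties
import Algebra.Properties.CommutativeSemigroup as CommutativeSemigroupProperties
import Algebra.Properties.Ring as RingProperties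

open import Defs

-- The p-adic integers form a commutative ring

module _ {m : ℤ} where
  open ≡ using (refl; sym; trans; subst)
  private
    neg-diff : ∀ a b → b ℤ.- a ≡ ℤ.- (a ℤ.- b)
    neg-diff = solve-∀
    +-diff : ∀ a a′ b b′ → (a ℤ.+ b) ℤ.- (a′ ℤ.+ b′) ≡ (a ℤ.- a′) ℤ.+ (b ℤ.- b′)
    +-diff = solve-∀
    *-diff : ∀ a a′ b b′ → (a ℤ.* b) ℤ.- (a′ ℤ.* b′) ≡ a ℤ.* (b ℤ.- b′) ℤ.+ (a ℤ.- a′) ℤ.* b′
    *-diff = solve-∀
    neg-neg-diff : ∀ a a′ → (ℤ.- a) ℤ.- (ℤ.- a′) ≡ ℤ.- (a ℤ.- a′)
    neg-neg-diff = solve-∀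

  ≡mod-reflexive : ∀ {a b} → a ≡ b → a ≡[mod m ] b
  ≡mod-reflexive {a} refl = divides (+ 0) (trans (ℤ.+-inverseʳ a) (sym (ℤ.*-zeroˡ m)))

  ≡mod-sym : ∀ {a b} → a ≡[mod m ] b → b ≡[mod m ] a
  ≡mod-sym {a} {b} d = subst (m ∣_) (sym (neg-diff a b)) (∣m⇒∣-m d)

  ≡mod-trans : ∀ {a b c} → a ≡[mod m ] b → b ≡[mod m ] c → a ≡[mod m ] c
  ≡mod-trans {a} {b} {c} d e = subst (m ∣_) (ℤ.+-minus-telescope a b c) (∣m∣n⇒∣m+n d e)

  ≡mod-+ : ∀ {a a′ b b′} → a ≡[mod m ] a′ → b ≡[mod m ] b′ → (a ℤ.+ b) ≡[mod m ] (a′ ℤ.+ b′)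
  ≡mod-+ {a} {a′} {b} {b′} d e = subst (m ∣_) (sym (+-diff a a′ b b′)) (∣m∣n⇒∣m+n d e)

  ≡mod-* : ∀ {a a′ b b′} → a ≡[mod m ] a′ → b ≡[mod m ] b′ → (a ℤ.* b) ≡[mod m ] (a′ ℤ.* b′)
  ≡mod-* {a} {a′} {b} {b′} d e =
    subst (m ∣_) (sym (*-diff a a′ b b′)) (∣m∣n⇒∣m+n (∣n⇒∣m*n a e) (∣m⇒∣m*n b′ d))

  ≡mod-neg : ∀ {a a′} → a ≡[mod m ] a′ → (ℤ.- a) ≡[mod m ] (ℤ.- a′)
  ≡mod-neg {a} {a′} d = subst (m ∣_) (sym (neg-neg-diff a a′)) (∣m⇒∣-m d)

module _ {p : ℕ} where
  open ≡ using (refl)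

  ≈ₚ-pointwise : ∀ {a b : ℤₚ p} → (∀ n → seq a n ≡ seq b n) → a ≈ₚ b
  ≈ₚ-pointwise {a} eq n = ≡mod-reflexive {a = seq a n} (eq n)

  private
    +ₚ-cong : ∀ {a a′ b b′ : ℤₚ p} → a ≈ₚ a′ → b ≈ₚ b′ → a +ₚ b ≈ₚ a′ +ₚ b′
    +ₚ-cong {a} {a′} {b} {b′} d e n = ≡mod-+ {a = seq a n} {seq a′ n} {seq b n} {seq b′ n} (d n) (e n)

    *ₚ-cong : ∀ {a a′ b b′ : ℤₚ p} → a ≈ₚ a′ → b ≈ₚ b′ → a *ₚ b ≈ₚ a′ *ₚ b′
    *ₚ-cong {a} {a′} {b} {b′} d e n = ≡mod-* {a = seq a n} {seq a′ n} {seq b n} {seq b′ n} (d n) (e n)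

    -ₚ-cong : ∀ {a a′ : ℤₚ p} → a ≈ₚ a′ → -ₚ a ≈ₚ -ₚ a′
    -ₚ-cong {a} {a′} d n = ≡mod-neg {a = seq a n} {seq a′ n} (d n)

  -- _≈ₚ_ unfolds to a Π-type, so its arguments cannot be inferred from a goal and are given by hand.
  ℤₚ-isCommutativeRing : IsCommutativeRing (_≈ₚ_ {p}) _+ₚ_ _*ₚ_ -ₚ_ 0ₚ 1ₚ
  ℤₚ-isCommutativeRing = record
    { isRing = record
      { +-isAbelianGroup = record
        { isGroup = record
          { isMonoid = record
            { isSemigroup = record
              { isMagma = record
                { isEquivalence = record
                  { refl  = λ {a} n → ≡mod-reflexive {a = seq a n} refl
                  ; sym   = λ {a} {b} d n → ≡mod-sym {a = seq a n} {seq b n} (d n)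
                  ; trans = λ {a} {b} {c} d e n → ≡mod-trans {a = seq a n} {seq b n} {seq c n} (d n) (e n)
                  }
                ; ∙-cong = λ {a} {a′} {b} {b′} → +ₚ-cong {a} {a′} {b} {b′}
                }
              ; assoc = λ a b c → ≈ₚ-pointwise {(a +ₚ b) +ₚ c} {a +ₚ (b +ₚ c)} λ n → ℤ.+-assoc (seq a n) (seq b n) (seq c n)
              }
            ; identity = (λ a → ≈ₚ-pointwise {0ₚ +ₚ a} {a} λ n → ℤ.+-identityˡ (seq a n))
                       , (λ a → ≈ₚ-pointwise {a +ₚ 0ₚ} {a} λ n → ℤ.+-identityʳ (seq a n))
            }
          ; inverse = (λ a → ≈ₚ-pointwise {(-ₚ a) +ₚ a} {0ₚ} λ n → ℤ.+-inverseˡ (seq a n))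
                    , (λ a → ≈ₚ-pointwise {a +ₚ (-ₚ a)} {0ₚ} λ n → ℤ.+-inverseʳ (seq a n))
          ; ⁻¹-cong = λ {a} {a′} → -ₚ-cong {a} {a′}
          }
        ; comm = λ a b → ≈ₚ-pointwise {a +ₚ b} {b +ₚ a} λ n → ℤ.+-comm (seq a n) (seq b n)
        }
      ; *-cong = λ {a} {a′} {b} {b′} → *ₚ-cong {a} {a′} {b} {b′}
      ; *-assoc = λ a b c → ≈ₚ-pointwise {(a *ₚ b) *ₚ c} {a *ₚ (b *ₚ c)} λ n → ℤ.*-assoc (seq a n) (seq b n) (seq c n)
      ; *-identity = (λ a → ≈ₚ-pointwise {1ₚ *ₚ a} {a} λ n → ℤ.*-identityˡ (seq a n))
                   , (λ a → ≈ₚ-pointwise {a *ₚ 1ₚ} {a} λ n → ℤ.*-identityʳ (seq a n))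
      ; distrib = (λ a b c → ≈ₚ-pointwise {a *ₚ (b +ₚ c)} {a *ₚ b +ₚ a *ₚ c}
                               λ n → ℤ.*-distribˡ-+ (seq a n) (seq b n) (seq c n))
                , (λ a b c → ≈ₚ-pointwise {(b +ₚ c) *ₚ a} {b *ₚ a +ₚ c *ₚ a}
                               λ n → ℤ.*-distribʳ-+ (seq a n) (seq b n) (seq c n))
      }
    ; *-comm = λ a b → ≈ₚ-pointwise {a *ₚ b} {b *ₚ a} λ n → ℤ.*-comm (seq a n) (seq b n)
    }

-- Finite abelian groups

module FinAbGroupProperties (G : FinAbGroup) where
  open ≡ using (refl; sym; trans; cong; cong₂)
  open FinAbGroup G
  open GroupNotions G
  open Inverse enum using (to; from; strictlyInverseˡ; strictlyInverseʳ)

  asAbelianGroup : AbelianGroup 0ℓ 0ℓ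
  asAbelianGroup = record { isAbelianGroup = isAbelianGroup }

  open AbelianGroup asAbelianGroup public
    using (assoc; comm; identityˡ; identityʳ; inverseˡ; inverseʳ)
  open AbelianGroupProperties asAbelianGroup public using (xyx⁻¹≈y; ⁻¹-∙-comm)
  open GroupProperties (AbelianGroup.group asAbelianGroup) public
    using (∙-cancelˡ; ∙-cancelʳ; ε⁻¹≈ε; \\-leftDividesˡ; //-rightDividesˡ; //-rightDividesʳ)
  open CommutativeSemigroupProperties (AbelianGroup.commutativeSemigroup asAbelianGroup) public
    using (x∙yz≈xz∙y; x∙yz≈y∙xz; xy∙z≈xz∙y)

  from-injective : ∀ {x y} → from x ≡ from y → x ≡ y
  from-injective {x} {y} eq = trans (sym (strictlyInverseˡ x)) (trans (cong to eq) (strictlyInverseˡ y))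

  ∙^⁻¹-suc : ∀ h g n → h ∙ (g ^ n) ⁻¹ ∙ g ⁻¹ ≡ h ∙ (g ^ suc n) ⁻¹
  ∙^⁻¹-suc h g n = trans (assoc h _ _) (cong (h ∙_) (trans (⁻¹-∙-comm (g ^ n) g) (cong _⁻¹ (comm (g ^ n) g))))

  x∙ε⁻¹≡x : ∀ x → x ∙ ε ⁻¹ ≡ x
  x∙ε⁻¹≡x x = trans (cong (x ∙_) ε⁻¹≈ε) (identityʳ x)

  x⁻¹∙y≡z⇒x≡y∙z⁻¹ : ∀ {t h g} → t ⁻¹ ∙ h ≡ g → t ≡ h ∙ g ⁻¹
  x⁻¹∙y≡z⇒x≡y∙z⁻¹ {t} {h} {g} eq = trans (sym (//-rightDividesʳ g t))
    (cong (_∙ g ⁻¹) (trans (cong (t ∙_) (sym eq)) (\\-leftDividesˡ t h)))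

  [x∙y⁻¹]⁻¹∙x≡y : ∀ x y → (x ∙ y ⁻¹) ⁻¹ ∙ x ≡ y
  [x∙y⁻¹]⁻¹∙x≡y x y = ∙-cancelˡ (x ∙ y ⁻¹) _ _
    (trans (\\-leftDividesˡ (x ∙ y ⁻¹) x) (sym (//-rightDividesˡ y x)))

  ^-+ : ∀ g a b → g ^ (a ℕ.+ b) ≡ g ^ a ∙ g ^ b
  ^-+ g zero    b = sym (identityˡ (g ^ b))
  ^-+ g (suc a) b = trans (cong (g ∙_) (^-+ g a b)) (sym (assoc g (g ^ a) (g ^ b)))

  ^-*-period : ∀ {g m} → g ^ m ≡ ε → ∀ q → g ^ (q ℕ.* m) ≡ ε
  ^-*-period         gᵐ≡ε zero    = refl
  ^-*-period {g} {m} gᵐ≡ε (suc q) = begin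
    g ^ (m ℕ.+ q ℕ.* m)      ≡⟨ ^-+ g m (q ℕ.* m) ⟩
    g ^ m ∙ g ^ (q ℕ.* m)    ≡⟨ cong₂ _∙_ gᵐ≡ε (^-*-period gᵐ≡ε q) ⟩
    ε ∙ ε                    ≡⟨ identityˡ ε ⟩
    ε                        ∎
    where open ≡-Reasoning

  ^-% : ∀ {g m} .{{_ : NonZero m}} → g ^ m ≡ ε → ∀ n → g ^ n ≡ g ^ (n % m)
  ^-% {g} {m} gᵐ≡ε n = begin
    g ^ n                                ≡⟨ cong (g ^_) (m≡m%n+[m/n]*n n m) ⟩
    g ^ (n % m ℕ.+ (n / m) ℕ.* m)        ≡⟨ ^-+ g (n % m) ((n / m) ℕ.* m) ⟩
    g ^ (n % m) ∙ g ^ ((n / m) ℕ.* m)    ≡⟨ cong (g ^ (n % m) ∙_) (^-*-period gᵐ≡ε (n / m)) ⟩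
    g ^ (n % m) ∙ ε                      ≡⟨ identityʳ (g ^ (n % m)) ⟩
    g ^ (n % m)                          ∎
    where open ≡-Reasoning

  private
    no-collision : ∀ {g m} → IsOrder g m → ∀ {a b} → a < b → b < m → g ^ a ≢ g ^ b
    no-collision {g} (_ , _ , minimal) {a} {b} a<b b<m gᵃ≡gᵇ =
      minimal (b ∸ a) (ℕ.m<n⇒0<n∸m a<b) (ℕ.≤-<-trans (ℕ.m∸n≤m b a) b<m) gᵇ⁻ᵃ≡ε
      where
        open ≡-Reasoning
        gᵇ⁻ᵃ≡ε : g ^ (b ∸ a) ≡ ε
        gᵇ⁻ᵃ≡ε = ∙-cancelʳ (g ^ a) _ _ (begin
          g ^ (b ∸ a) ∙ g ^ a    ≡⟨ sym (^-+ g (b ∸ a) a) ⟩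
          g ^ (b ∸ a ℕ.+ a)      ≡⟨ cong (g ^_) (ℕ.m∸n+n≡m (ℕ.<⇒≤ a<b)) ⟩
          g ^ b                  ≡⟨ sym gᵃ≡gᵇ ⟩
          g ^ a                  ≡⟨ sym (identityˡ (g ^ a)) ⟩
          ε ∙ g ^ a              ∎)

  ^-injective : ∀ {g m} → IsOrder g m → ∀ {a b} → a < m → b < m → g ^ a ≡ g ^ b → a ≡ b
  ^-injective order {a} {b} a<m b<m gᵃ≡gᵇ with ℕ.<-cmp a b
  ... | tri< a<b _ _ = ⊥-elim (no-collision order a<b b<m gᵃ≡gᵇ)
  ... | tri≈ _ a≡b _ = a≡b
  ... | tri> _ _ b<a = ⊥-elim (no-collision order b<a a<m (sym gᵃ≡gᵇ))

  ∏-cong : ∀ {n} {f f′ : Fin n → Carrier} → (∀ i → f i ≡ f′ i) → ∏ f ≡ ∏ f′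
  ∏-cong {zero}  _  = refl
  ∏-cong {suc n} eq = cong₂ _∙_ (eq Fin.zero) (∏-cong (eq ∘ Fin.suc))

  ∏-^-updateAt-suc : ∀ {n} (g : Fin n → Carrier) (b : Fin n → ℕ) j →
                     ∏ (λ i → g i ^ updateAt b j suc i) ≡ g j ∙ ∏ (λ i → g i ^ b i)
  ∏-^-updateAt-suc {suc n} g b Fin.zero =
    assoc (g Fin.zero) (g Fin.zero ^ b Fin.zero) (∏ (λ i → g (Fin.suc i) ^ b (Fin.suc i)))
  ∏-^-updateAt-suc {suc n} g b (Fin.suc j) = begin
    g₀ ^ b₀ ∙ ∏ (λ i → g (Fin.suc i) ^ updateAt (b ∘ Fin.suc) j suc i)
      ≡⟨ cong (g₀ ^ b₀ ∙_) (∏-^-updateAt-suc (g ∘ Fin.suc) (b ∘ Fin.suc) j) ⟩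
    g₀ ^ b₀ ∙ (g (Fin.suc j) ∙ ∏ (λ i → g (Fin.suc i) ^ b (Fin.suc i)))
      ≡⟨ x∙yz≈y∙xz (g₀ ^ b₀) (g (Fin.suc j)) _ ⟩
    g (Fin.suc j) ∙ (g₀ ^ b₀ ∙ ∏ (λ i → g (Fin.suc i) ^ b (Fin.suc i)))
      ∎
    where
      open ≡-Reasoning
      g₀ = g Fin.zero
      b₀ = b Fin.zero

-- Coordinates on a finite abelian group from an internal direct product

module DirectProductCoordinates (G : FinAbGroup) where
  open ≡ using (refl; sym; trans; cong)
  open FinAbGroup G
  open GroupNotions G
  open FinAbGroupProperties G
  open Inverse enum using (from)

  record CyclicCoordinate (γ : Carrier) (m : ℕ) : Set where
    field
      period     : γ ^ m ≡ ε
      coord      : Carrier → ℕ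
      coord<     : ∀ h → coord h < m
      coord-step : ∀ h → suc (coord h) < m → coord (h ∙ γ ⁻¹) ≡ suc (coord h)
      coord-wrap : ∀ h → suc (coord h) ≡ m → coord (h ∙ γ ⁻¹) ≡ 0

  open CyclicCoordinate public

  record Coordinates {r} (g : Fin r → Carrier) (o : Fin r → ℕ) : Set where
    field
      cyclic      : ∀ i → CyclicCoordinate (g i) (o i)
      independent : ∀ i j → i ≢ j → ∀ h → coord (cyclic i) (h ∙ g j ⁻¹) ≡ coord (cyclic i) h

  open Coordinates public

  restrict : ∀ {k r} {g : Fin r → Carrier} {o : Fin r → ℕ} → Coordinates g o →
             (ρ : Fin k → Fin r) → (∀ {i j} → ρ i ≡ ρ j → i ≡ j) → Coordinates (g ∘ ρ) (o ∘ ρ)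
  restrict C ρ ρ-injective = record
    { cyclic      = cyclic C ∘ ρ
    ; independent = λ i j i≢j → independent C (ρ i) (ρ j) (i≢j ∘ ρ-injective)
    }

  private
    idx : Carrier → ℕ
    idx = toℕ ∘ from

    idx-injective : ∀ {x y} → idx x ≡ idx y → x ≡ y
    idx-injective = from-injective ∘ Fin.toℕ-injective

    min≤ : ℕ → (ℕ → ℕ) → ℕ
    min≤ zero    φ = φ 0
    min≤ (suc n) φ = φ 0 ⊓ min≤ n (φ ∘ suc)

    min≤-attained : ∀ n φ → ∃[ s ] (s ≤ n × min≤ n φ ≡ φ s)
    min≤-attained zero    φ = 0 , z≤n , refl
    min≤-attained (suc n) φ with ℕ.⊓-sel (φ 0) (min≤ n (φ ∘ suc))
    ... | inj₁ eq = 0 , z≤n , eq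
    ... | inj₂ eq with min≤-attained n (φ ∘ suc)
    ...   | s , s≤n , eq′ = suc s , s≤s s≤n , trans eq eq′

    min≤-lowerBound : ∀ n φ {s} → s ≤ n → min≤ n φ ≤ φ s
    min≤-lowerBound zero    φ z≤n       = ℕ.≤-refl
    min≤-lowerBound (suc n) φ {zero}  _ = ℕ.m⊓n≤m (φ 0) _
    min≤-lowerBound (suc n) φ {suc s} (s≤s s≤n) =
      ℕ.≤-trans (ℕ.m⊓n≤n (φ 0) _) (min≤-lowerBound n (φ ∘ suc) s≤n)

  Below : ∀ {r} → (Fin r → ℕ) → (Fin r → ℕ) → Set
  Below o b = ∀ i → b i < o i

  _^⃗_ : ∀ {r} → (Fin r → Carrier) → (Fin r → ℕ) → Carrier
  g ^⃗ b = ∏ (λ i → g i ^ b i)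

  cosetIndex : ∀ {r} → (Fin r → Carrier) → (Fin r → ℕ) → Carrier → ℕ
  cosetIndex {zero}  g o h = idx h
  cosetIndex {suc r} g o h =
    min≤ (pred (o Fin.zero)) (λ s → cosetIndex (g ∘ Fin.suc) (o ∘ Fin.suc) (h ∙ g Fin.zero ^ s))

  cosetIndex-attained : ∀ {r} (g : Fin r → Carrier) o → (∀ i → 0 < o i) → ∀ h →
                        Σ (Fin r → ℕ) λ b → Below o b × cosetIndex g o h ≡ idx (h ∙ g ^⃗ b)
  cosetIndex-attained {zero} g o _ h = (λ ()) , (λ ()) , cong idx (sym (identityʳ h))
  cosetIndex-attained {suc r} g o o>0 h
    with min≤-attained (pred (o Fin.zero)) (λ s → cosetIndex (g ∘ Fin.suc) (o ∘ Fin.suc) (h ∙ g Fin.zero ^ s))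
  ... | s , s≤pred , eq
    with cosetIndex-attained (g ∘ Fin.suc) (o ∘ Fin.suc) (o>0 ∘ Fin.suc) (h ∙ g Fin.zero ^ s)
  ...   | b , b-below , eq′ = b′ , b′-below , trans eq (trans eq′ (cong idx (assoc h _ _)))
    where
      b′ : Fin (suc r) → ℕ
      b′ Fin.zero    = s
      b′ (Fin.suc i) = b i
      b′-below : Below o b′
      b′-below Fin.zero    = ℕ.m≤pred[n]⇒suc[m]≤n {{>-nonZero (o>0 Fin.zero)}} s≤pred
      b′-below (Fin.suc i) = b-below i

  cosetIndex-minimal : ∀ {r} (g : Fin r → Carrier) o h b → Below o b → cosetIndex g o h ≤ idx (h ∙ g ^⃗ b)
  cosetIndex-minimal {zero}  g o h b _ = ℕ.≤-reflexive (cong idx (sym (identityʳ h)))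
  cosetIndex-minimal {suc r} g o h b b-below = ℕ.≤-trans
    (min≤-lowerBound _ _ (ℕ.suc[m]≤n⇒m≤pred[n] (b-below Fin.zero)))
    (ℕ.≤-trans (cosetIndex-minimal (g ∘ Fin.suc) (o ∘ Fin.suc) _ (b ∘ Fin.suc) (b-below ∘ Fin.suc))
               (ℕ.≤-reflexive (cong idx (assoc h _ _))))

  module _ {r} {g : Fin r → Carrier} {o : Fin r → ℕ} (order : ∀ i → IsOrder (g i) (o i)) where
    private
      o>0 : ∀ i → 0 < o i
      o>0 i = proj₁ (order i)

      period′ : ∀ i → g i ^ o i ≡ ε
      period′ i = proj₁ (proj₂ (order i))

      _%o_ : ℕ → Fin r → ℕ
      n %o i = _%_ n (o i) {{>-nonZero (o>0 i)}}

      ^-%o : ∀ i n → g i ^ n ≡ g i ^ (n %o i)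
      ^-%o i n = ^-% {{>-nonZero (o>0 i)}} (period′ i) n

      ≤-iterate : (f : ℕ → ℕ) → (∀ s → f s ≤ f (suc s)) → ∀ {a b} → a ≤ b → f a ≤ f b
      ≤-iterate f step a≤b = go (ℕ.≤⇒≤′ a≤b)
        where
          go : ∀ {a b} → a ℕ.≤′ b → f a ≤ f b
          go (ℕ.≤′-reflexive refl) = ℕ.≤-refl
          go (ℕ.≤′-step a≤′b)      = ℕ.≤-trans (go a≤′b) (step _)

    cosetIndex-≤-∙ : ∀ j h → cosetIndex g o h ≤ cosetIndex g o (h ∙ g j)
    cosetIndex-≤-∙ j h with cosetIndex-attained g o o>0 (h ∙ g j)
    ... | b , _ , eq = ℕ.≤-trans (cosetIndex-minimal g o h b′ b′-below) (ℕ.≤-reflexive (begin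
      idx (h ∙ g ^⃗ b′)                              ≡⟨ cong (λ x → idx (h ∙ x)) (∏-cong λ i → sym (^-%o i _)) ⟩
      idx (h ∙ g ^⃗ updateAt b j suc)                ≡⟨ cong (λ x → idx (h ∙ x)) (∏-^-updateAt-suc g b j) ⟩
      idx (h ∙ (g j ∙ g ^⃗ b))                       ≡⟨ cong idx (sym (assoc h (g j) (g ^⃗ b))) ⟩
      idx (h ∙ g j ∙ g ^⃗ b)                         ≡⟨ sym eq ⟩
      cosetIndex g o (h ∙ g j)                      ∎))
      where
        open ≡-Reasoning
        b′ : Fin r → ℕ
        b′ i = updateAt b j suc i %o i
        b′-below : Below o b′
        b′-below i = m%n<n (updateAt b j suc i) (o i) {{>-nonZero (o>0 i)}}

    cosetIndex-∙ : ∀ j h → cosetIndex g o (h ∙ g j) ≡ cosetIndex g o h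
    cosetIndex-∙ j h = ℕ.≤-antisym (begin
      cosetIndex g o (h ∙ g j)    ≡⟨ cong (λ x → cosetIndex g o (h ∙ x)) (identityʳ (g j)) ⟨
      f 1                         ≤⟨ ≤-iterate f step (o>0 j) ⟩
      f (o j)                     ≡⟨ cong (λ x → cosetIndex g o (h ∙ x)) (period′ j) ⟩
      cosetIndex g o (h ∙ ε)      ≡⟨ cong (cosetIndex g o) (identityʳ h) ⟩
      cosetIndex g o h            ∎)
      (cosetIndex-≤-∙ j h)
      where
        open ℕ.≤-Reasoning
        f : ℕ → ℕ
        f s = cosetIndex g o (h ∙ g j ^ s)
        step : ∀ s → f s ≤ f (suc s)
        step s = ℕ.≤-trans (cosetIndex-≤-∙ j (h ∙ g j ^ s))
                           (ℕ.≤-reflexive (cong (cosetIndex g o) (sym (x∙yz≈xz∙y h (g j) (g j ^ s)))))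

    exponents : Carrier → Fin r → ℕ
    exponents h = proj₁ (cosetIndex-attained g o o>0 h)

    exponents-below : ∀ h → Below o (exponents h)
    exponents-below h = proj₁ (proj₂ (cosetIndex-attained g o o>0 h))

    private
      representative : Carrier → Carrier
      representative h = h ∙ g ^⃗ exponents h

      representative-∙ : ∀ j h → representative (h ∙ g j) ≡ representative h
      representative-∙ j h = idx-injective (begin
        idx (representative (h ∙ g j))    ≡⟨ proj₂ (proj₂ (cosetIndex-attained g o o>0 (h ∙ g j))) ⟨
        cosetIndex g o (h ∙ g j)          ≡⟨ cosetIndex-∙ j h ⟩
        cosetIndex g o h                  ≡⟨ proj₂ (proj₂ (cosetIndex-attained g o o>0 h)) ⟩
        idx (representative h)            ∎)
        where open ≡-Reasoning

    exponents-∙⁻¹ : ∀ j h → g ^⃗ exponents (h ∙ g j ⁻¹) ≡ g ^⃗ updateAt (exponents h) j suc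
    exponents-∙⁻¹ j h = ∙-cancelˡ (h ∙ g j ⁻¹) _ _ (begin
      h ∙ g j ⁻¹ ∙ g ^⃗ exponents (h ∙ g j ⁻¹)          ≡⟨ representative-∙ j (h ∙ g j ⁻¹) ⟨
      representative (h ∙ g j ⁻¹ ∙ g j)                 ≡⟨ cong representative (//-rightDividesˡ (g j) h) ⟩
      h ∙ g ^⃗ exponents h                               ≡⟨ cong (_∙ g ^⃗ exponents h) (//-rightDividesˡ (g j) h) ⟨
      h ∙ g j ⁻¹ ∙ g j ∙ g ^⃗ exponents h                ≡⟨ assoc (h ∙ g j ⁻¹) (g j) (g ^⃗ exponents h) ⟩
      h ∙ g j ⁻¹ ∙ (g j ∙ g ^⃗ exponents h)              ≡⟨ cong (h ∙ g j ⁻¹ ∙_) (∏-^-updateAt-suc g (exponents h) j) ⟨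
      h ∙ g j ⁻¹ ∙ g ^⃗ updateAt (exponents h) j suc     ∎)
      where open ≡-Reasoning

    -- The exponents reaching the least element of h⟨g⟩ are the coordinates of h.
    directProductCoordinates : IsInternalDirectProduct g → Coordinates g o
    directProductCoordinates direct = record { cyclic = cyclicᵢ ; independent = independentᵢ }
      where
        shifted : ∀ j h i → g i ^ exponents (h ∙ g j ⁻¹) i ≡ g i ^ updateAt (exponents h) j suc i
        shifted j h = direct (exponents (h ∙ g j ⁻¹)) (updateAt (exponents h) j suc) (exponents-∙⁻¹ j h)

        exponents-next : ∀ j h → exponents (h ∙ g j ⁻¹) j ≡ suc (exponents h j) %o j
        exponents-next j h = ^-injective (order j) (exponents-below _ j)
          (m%n<n (suc (exponents h j)) (o j) {{>-nonZero (o>0 j)}}) (begin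
            g j ^ exponents (h ∙ g j ⁻¹) j          ≡⟨ shifted j h j ⟩
            g j ^ updateAt (exponents h) j suc j    ≡⟨ cong (g j ^_) (updateAt-updates j (exponents h)) ⟩
            g j ^ suc (exponents h j)               ≡⟨ ^-%o j _ ⟩
            g j ^ (suc (exponents h j) %o j)        ∎)
          where open ≡-Reasoning

        cyclicᵢ : ∀ i → CyclicCoordinate (g i) (o i)
        cyclicᵢ i = record
          { period     = period′ i
          ; coord      = λ h → exponents h i
          ; coord<     = λ h → exponents-below h i
          ; coord-step = λ h step → trans (exponents-next i h) (m<n⇒m%n≡m {{>-nonZero (o>0 i)}} step)
          ; coord-wrap = λ h wrap → trans (exponents-next i h)
                           (trans (cong (_%o i) wrap) (n%n≡0 (o i) {{>-nonZero (o>0 i)}}))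
          }

        independentᵢ : ∀ i j → i ≢ j → ∀ h → exponents (h ∙ g j ⁻¹) i ≡ exponents h i
        independentᵢ i j i≢j h = ^-injective (order i) (exponents-below _ i) (exponents-below h i)
          (trans (shifted j h i) (cong (g i ^_) (updateAt-minimal i j (exponents h) i≢j)))

-- Finite families and sums

module _ {a} {A : Set a} where
  open ≡ using (refl)

  ++-suc : ∀ {m n} (xs : Fin (suc m) → A) (ys : Fin n → A) i → (xs ++ ys) (Fin.suc i) ≡ ((xs ∘ Fin.suc) ++ ys) i
  ++-suc {m} xs ys i with Fin.splitAt m i
  ... | inj₁ _ = refl
  ... | inj₂ _ = refl

  ++-all : ∀ {p} (P : A → Set p) {m n} {xs : Fin m → A} {ys : Fin n → A} →
           (∀ i → P (xs i)) → (∀ i → P (ys i)) → ∀ i → P ((xs ++ ys) i)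
  ++-all P {m} P-xs P-ys i with Fin.splitAt m i
  ... | inj₁ j = P-xs j
  ... | inj₂ j = P-ys j

  ++-zipWith : ∀ {b c} {B : Set b} {C : Set c} (f : A → B → C) {m n} (xs : Fin m → A) (xs′ : Fin n → A) ys ys′ i →
               f ((xs ++ xs′) i) ((ys ++ ys′) i) ≡ ((λ j → f (xs j) (ys j)) ++ (λ j → f (xs′ j) (ys′ j))) i
  ++-zipWith f {m} xs xs′ ys ys′ i with Fin.splitAt m i
  ... | inj₁ _ = refl
  ... | inj₂ _ = refl

module _ where
  open import Algebra.Properties.Semiring.Sum ℕ.+-*-semiring using (sum; ∑-distrib-+; *-distribˡ-sum; sum-cong-≗)
  open ≡ using (refl; sym; trans; cong; cong₂)

  private
    sum-shift : ∀ m (q : ℕ → ℕ) → sum {m} (λ s → q (suc (toℕ s))) ℕ.+ q 0 ≡ sum {m} (λ s → q (toℕ s)) ℕ.+ q m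
    sum-shift zero    q = refl
    sum-shift (suc m) q = begin
      q 1 ℕ.+ S′ ℕ.+ q 0      ≡⟨ ℕ.+-comm (q 1 ℕ.+ S′) (q 0) ⟩
      q 0 ℕ.+ (q 1 ℕ.+ S′)    ≡⟨ cong (q 0 ℕ.+_) (ℕ.+-comm (q 1) S′) ⟩
      q 0 ℕ.+ (S′ ℕ.+ q 1)    ≡⟨ cong (q 0 ℕ.+_) (sum-shift m (q ∘ suc)) ⟩
      q 0 ℕ.+ (S ℕ.+ q (suc m))  ≡⟨ ℕ.+-assoc (q 0) S (q (suc m)) ⟨
      q 0 ℕ.+ S ℕ.+ q (suc m)    ∎
      where
        open ≡-Reasoning
        S S′ : ℕ
        S  = sum {m} (λ s → q (suc (toℕ s)))
        S′ = sum {m} (λ s → q (suc (suc (toℕ s))))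

  -- Summing the step equations over a full period gives m · #wraps = m.
  wraps-once : ∀ m (pos : ℕ → ℕ) (wraps : ℕ → Bool) → 0 < m → pos m ≡ pos 0 →
               (∀ s → pos (suc s) ℕ.+ (if wraps s then m else 0) ≡ suc (pos s)) →
               sum {m} (λ s → if wraps (toℕ s) then 1 else 0) ≡ 1
  wraps-once m pos wraps m>0 periodic step = ℕ.*-cancelˡ-≡ _ 1 m {{>-nonZero m>0}} (ℕ.+-cancelˡ-≡ P _ _ (begin
    P ℕ.+ m ℕ.* W
      ≡⟨ cong (P ℕ.+_) (*-distribˡ-sum m wrapped) ⟩
    P ℕ.+ sum {m} (λ s → m ℕ.* wrapped s)
      ≡⟨ cong (P ℕ.+_) (sum-cong-≗ {m} m*wrapped) ⟩
    P ℕ.+ sum {m} (λ s → if wraps (toℕ s) then m else 0)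
      ≡⟨ ∑-distrib-+ {m} (λ s → pos (suc (toℕ s))) _ ⟨
    sum {m} (λ s → pos (suc (toℕ s)) ℕ.+ (if wraps (toℕ s) then m else 0))
      ≡⟨ sum-cong-≗ {m} (step ∘ toℕ) ⟩
    sum {m} (λ s → 1 ℕ.+ pos (toℕ s))
      ≡⟨ ∑-distrib-+ {m} (λ _ → 1) (λ s → pos (toℕ s)) ⟩
    sum {m} (λ _ → 1) ℕ.+ Q
      ≡⟨ ℕ.+-comm (sum {m} (λ _ → 1)) Q ⟩
    Q ℕ.+ sum {m} (λ _ → 1)
      ≡⟨ cong₂ ℕ._+_ P≡Q (sym (sum-ones m)) ⟨
    P ℕ.+ m
      ≡⟨ cong (P ℕ.+_) (ℕ.*-identityʳ m) ⟨
    P ℕ.+ m ℕ.* 1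
      ∎))
    where
      open ≡-Reasoning
      wrapped : Fin m → ℕ
      wrapped s = if wraps (toℕ s) then 1 else 0
      W P Q : ℕ
      W = sum wrapped
      P = sum {m} (λ s → pos (suc (toℕ s)))
      Q = sum {m} (λ s → pos (toℕ s))
      m*wrapped : ∀ s → m ℕ.* wrapped s ≡ (if wraps (toℕ s) then m else 0)
      m*wrapped s with wraps (toℕ s)
      ... | true  = ℕ.*-identityʳ m
      ... | false = ℕ.*-zeroʳ m
      P≡Q : P ≡ Q
      P≡Q = ℕ.+-cancelʳ-≡ (pos 0) P Q (trans (sum-shift m pos) (cong (Q ℕ.+_) periodic))
      sum-ones : ∀ n → sum {n} (λ _ → 1) ≡ n
      sum-ones zero    = refl
      sum-ones (suc n) = cong suc (sum-ones n)

-- The group algebra K[G] of a finite abelian group over a commutative ring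

module GroupAlgebra {c ℓ} (K : CommutativeRing c ℓ) (G : FinAbGroup) where
  open CommutativeRing K renaming (Carrier to ∣K∣)
  open RingProperties ring using (-‿involutive; -‿+-comm; -‿distribʳ-*; -‿distribˡ-*; -0#≈0#)
  open CommutativeSemigroupProperties +-commutativeSemigroup using (interchange)
  open GroupProperties +-group using ()
    renaming (//-rightDividesˡ to x-y+y≈x; //-rightDividesʳ to x+y-y≈x; x∙y⁻¹≈ε⇒x≈y to x-y≈0⇒x≈y;
              inverseˡ-unique to x+y≈0⇒x≈-y)
  import Algebra.Properties.Semiring.Sum ℕ.+-*-semiring as ℕΣ
  open import Algebra.Properties.Semiring.Sum semiring
    using (sum; sum-cong-≋; sum-cong-≗; ∑-distrib-+; ∑-comm; sum-remove; sum-replicate-zero; *-distribˡ-sum)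
  open import Relation.Binary.Reasoning.Setoid setoid

  open FinAbGroup G renaming (Carrier to Γ) using (_∙_; ε; _⁻¹; size; enum)
  open GroupNotions G using (_^_)
  open FinAbGroupProperties G
  open DirectProductCoordinates G
    using (CyclicCoordinate; period; coord; coord<; coord-step; coord-wrap; Coordinates; cyclic; independent; restrict)
  open Inverse enum using (to; from; strictlyInverseˡ; strictlyInverseʳ)

  -- The notions of Defs.GroupRing with ℤₚ replaced by K, and finite sums taken with `sum`.
  R : Set c
  R = Γ → ∣K∣

  infix 4 _≈R_
  _≈R_ : R → R → Set ℓ
  x ≈R y = ∀ h → x h ≈ y h

  infixl 6 _+R_
  infixl 7 _*R_
  _+R_ : R → R → R
  (x +R y) h = x h + y h

  -R_ : R → R
  (-R x) h = - x h

  0R : R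
  0R _ = 0#

  ⟦_⟧ : Γ → R
  ⟦ g ⟧ h = if does (from h Fin.≟ from g) then 1# else 0#

  1R : R
  1R = ⟦ ε ⟧

  _*R_ : R → R → R
  (x *R y) h = sum (λ i → x (to i) * y ((to i ⁻¹) ∙ h))

  ΣR : ∀ {n} → (Fin n → R) → R
  ΣR f h = sum (λ i → f i h)

  β : Γ → R
  β g = ⟦ g ⟧ +R (-R 1R)

  α : Γ → ℕ → R
  α g m = ΣR {m} (λ k → ⟦ g ^ suc (toℕ k) ⟧)

  Vecᴿ : ℕ → Set c
  Vecᴿ k = Fin k → R

  infix 4 _≈V_
  _≈V_ : ∀ {k} → Vecᴿ k → Vecᴿ k → Set ℓ
  u ≈V v = ∀ i → u i ≈R v i

  _+V_ : ∀ {k} → Vecᴿ k → Vecᴿ k → Vecᴿ k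
  (u +V v) i = u i +R v i

  _·V_ : ∀ {k} → R → Vecᴿ k → Vecᴿ k
  (a ·V v) i = a *R v i

  ΣV : ∀ {k n} → (Fin n → Vecᴿ k) → Vecᴿ k
  ΣV f i = ΣR (λ j → f j i)

  e : ∀ {k} → Fin k → Vecᴿ k
  e i j = if does (i Fin.≟ j) then 1R else 0R

  Kernel : ∀ {k} → (Fin k → Γ) → Vecᴿ k → Set ℓ
  Kernel g y = ΣR (λ i → y i *R β (g i)) ≈R 0R

  InSpan : ∀ {k} → (Vecᴿ k → Set ℓ) → Vecᴿ k → Set (c ⊔ ℓ)
  InSpan {k} S y =
    ∃[ n ] Σ (Fin n → Vecᴿ k) λ v → Σ (Fin n → R) λ a →
      (∀ j → S (v j)) × (y ≈V ΣV (λ j → a j ·V v j))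

  GeneratedBy : ∀ {k} → (Vecᴿ k → Set ℓ) → (Vecᴿ k → Set ℓ) → Set (c ⊔ ℓ)
  GeneratedBy P S = (∀ v → S v → P v) × (∀ y → P y → InSpan S y)

  Generators : ∀ {k} → (Fin k → Γ) → (Fin k → ℕ) → Vecᴿ k → Set ℓ
  Generators g m v =
    (∃[ i ] v ≈V (α (g i) (m i) ·V e i))
    ⊎ (∃[ i ] ∃[ j ] (i Fin.< j) × (v ≈V (((-R β (g j)) ·V e i) +V (β (g i) ·V e j))))

  private
    [b-a]+[c-b]≈c-a : ∀ a b c → (b - a) + (c - b) ≈ c - a
    [b-a]+[c-b]≈c-a a b c = begin
      (b - a) + (c - b)       ≈⟨ +-comm (b - a) (c - b) ⟩
      (c - b) + (b - a)       ≈⟨ +-assoc c (- b) (b - a) ⟩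
      c + (- b + (b - a))     ≈⟨ +-congˡ (+-assoc (- b) b (- a)) ⟨
      c + ((- b + b) - a)     ≈⟨ +-congˡ (+-congʳ (-‿inverseˡ b)) ⟩
      c + (0# - a)            ≈⟨ +-congˡ (+-identityˡ (- a)) ⟩
      c - a                   ∎

    [a-b]-[c-d]≈[a-c]-[b-d] : ∀ a b c d → (a - b) - (c - d) ≈ (a - c) - (b - d)
    [a-b]-[c-d]≈[a-c]-[b-d] a b c d = begin
      (a - b) - (c - d)       ≈⟨ +-congˡ (-‿+-comm c (- d)) ⟨
      (a - b) + (- c - - d)   ≈⟨ interchange a (- b) (- c) (- - d) ⟩
      (a - c) + (- b - - d)   ≈⟨ +-congˡ (-‿+-comm b (- d)) ⟩
      (a - c) - (b - d)       ∎

  sum-zero : ∀ {n} (f : Fin n → ∣K∣) → (∀ i → f i ≈ 0#) → sum f ≈ 0#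
  sum-zero {n} f f≈0 = trans (sum-cong-≋ f≈0) (sum-replicate-zero n)

  sum-single : ∀ {n} (f : Fin n → ∣K∣) j → (∀ i → i ≢ j → f i ≈ 0#) → sum f ≈ f j
  sum-single {suc n} f j f≈0 = begin
    sum f                       ≈⟨ sum-remove {i = j} f ⟩
    f j + sum (removeAt f j)    ≈⟨ +-congˡ (sum-zero _ λ i → f≈0 (Fin.punchIn j i) (Fin.punchInᵢ≢i j i)) ⟩
    f j + 0#                    ≈⟨ +-identityʳ (f j) ⟩
    f j                         ∎

  sum-neg : ∀ {n} (f : Fin n → ∣K∣) → sum (λ i → - f i) ≈ - sum f
  sum-neg {zero}  f = sym -0#≈0#
  sum-neg {suc n} f = trans (+-congˡ (sum-neg (f ∘ Fin.suc))) (-‿+-comm (f Fin.zero) (sum (f ∘ Fin.suc)))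

  sum-telescope : ∀ m (φ : ℕ → ∣K∣) → sum {m} (λ s → φ (suc (toℕ s)) - φ (toℕ s)) ≈ φ m - φ 0
  sum-telescope zero    φ = sym (-‿inverseʳ (φ 0))
  sum-telescope (suc m) φ =
    trans (+-congˡ (sum-telescope m (φ ∘ suc))) ([b-a]+[c-b]≈c-a (φ 0) (φ 1) (φ (suc m)))

  sum-++ : ∀ {m n} (f : Fin m → ∣K∣) (g : Fin n → ∣K∣) → sum (f ++ g) ≈ sum f + sum g
  sum-++ {zero}  f g = sym (+-identityˡ (sum g))
  sum-++ {suc m} f g = trans (+-congˡ (trans (reflexive (sum-cong-≗ (++-suc f g))) (sum-++ (f ∘ Fin.suc) g)))
                             (sym (+-assoc (f Fin.zero) _ _))

  private
    sum-select-none : ∀ {n} (b : Fin n → Bool) a → ℕΣ.sum (λ s → if b s then 1 else 0) ≡ 0 →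
                      sum (λ s → if b s then a else 0#) ≈ 0#
    sum-select-none {zero}  b a _ = refl
    sum-select-none {suc n} b a none with b Fin.zero
    ... | false = trans (+-identityˡ _) (sum-select-none (b ∘ Fin.suc) a none)

  sum-select : ∀ {n} (b : Fin n → Bool) a → ℕΣ.sum (λ s → if b s then 1 else 0) ≡ 1 →
               sum (λ s → if b s then a else 0#) ≈ a
  sum-select {suc n} b a once with b Fin.zero
  ... | true  = trans (+-congˡ (sum-select-none (b ∘ Fin.suc) a (ℕ.suc-injective once))) (+-identityʳ a)
  ... | false = trans (+-identityˡ _) (sum-select (b ∘ Fin.suc) a once)

  ⟦⟧-same : ∀ g → ⟦ g ⟧ g ≡ 1#
  ⟦⟧-same g with from g Fin.≟ from g
  ... | yes _ = ≡.refl
  ... | no ¬eq = ⊥-elim (¬eq ≡.refl)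

  ⟦⟧-other : ∀ {g h} → h ≢ g → ⟦ g ⟧ h ≡ 0#
  ⟦⟧-other {g} {h} h≢g with from h Fin.≟ from g
  ... | yes eq = ⊥-elim (h≢g (from-injective eq))
  ... | no _   = ≡.refl

  ⟦⟧-translate : ∀ g a h → ⟦ g ⟧ (h ∙ a ⁻¹) ≡ ⟦ a ∙ g ⟧ h
  ⟦⟧-translate g a h with from h Fin.≟ from (a ∙ g)
  ... | yes eq = ≡.trans (≡.cong ⟦ g ⟧ ha⁻¹≡g) (⟦⟧-same g)
    where
      ha⁻¹≡g : h ∙ a ⁻¹ ≡ g
      ha⁻¹≡g = ≡.trans (≡.cong (_∙ a ⁻¹) (from-injective eq)) (xyx⁻¹≈y a g)
  ... | no ¬eq = ⟦⟧-other λ ha⁻¹≡g → ¬eq (≡.cong from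
      (≡.trans (≡.sym (//-rightDividesˡ a h)) (≡.trans (≡.cong (_∙ a) ha⁻¹≡g) (comm g a))))

  *R-cong : ∀ {x x′ y y′} → x ≈R x′ → y ≈R y′ → x *R y ≈R x′ *R y′
  *R-cong x≈x′ y≈y′ h = sum-cong-≋ {size} λ i → *-cong (x≈x′ _) (y≈y′ _)

  *R-congʳ : ∀ y {x x′} → x ≈R x′ → x *R y ≈R x′ *R y
  *R-congʳ y x≈x′ = *R-cong {y = y} {y′ = y} x≈x′ (λ _ → refl)

  *R-congˡ : ∀ x {y y′} → y ≈R y′ → x *R y ≈R x *R y′
  *R-congˡ x y≈y′ = *R-cong {x = x} {x′ = x} (λ _ → refl) y≈y′

  *R-distribˡ : ∀ x y z → x *R (y +R z) ≈R x *R y +R x *R z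
  *R-distribˡ x y z h = trans (sum-cong-≋ {size} λ i → distribˡ _ _ _) (∑-distrib-+ {size} _ _)

  *R-distribʳ : ∀ x y z → (y +R z) *R x ≈R y *R x +R z *R x
  *R-distribʳ x y z h = trans (sum-cong-≋ {size} λ i → distribʳ _ _ _) (∑-distrib-+ {size} _ _)

  *R-negʳ : ∀ x y → x *R (-R y) ≈R -R (x *R y)
  *R-negʳ x y h = trans (sum-cong-≋ {size} λ i → sym (-‿distribʳ-* _ _)) (sum-neg {size} _)

  *R-negˡ : ∀ x y → (-R x) *R y ≈R -R (x *R y)
  *R-negˡ x y h = trans (sum-cong-≋ {size} λ i → sym (-‿distribˡ-* _ _)) (sum-neg {size} _)

  *R-zeroʳ : ∀ x → x *R 0R ≈R 0R
  *R-zeroʳ x h = sum-zero {size} _ λ i → zeroʳ _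

  *R-zeroˡ : ∀ y → 0R *R y ≈R 0R
  *R-zeroˡ y h = sum-zero {size} _ λ i → zeroˡ _

  *R-⟦⟧ : ∀ x g h → (x *R ⟦ g ⟧) h ≈ x (h ∙ g ⁻¹)
  *R-⟦⟧ x g h = begin
    sum (λ i → x (to i) * ⟦ g ⟧ (to i ⁻¹ ∙ h))
      ≈⟨ sum-single _ j vanish ⟩
    x (to j) * ⟦ g ⟧ (to j ⁻¹ ∙ h)
      ≡⟨ ≡.cong (λ t → x t * ⟦ g ⟧ (t ⁻¹ ∙ h)) (strictlyInverseˡ (h ∙ g ⁻¹)) ⟩
    x (h ∙ g ⁻¹) * ⟦ g ⟧ ((h ∙ g ⁻¹) ⁻¹ ∙ h)
      ≡⟨ ≡.cong (λ t → x (h ∙ g ⁻¹) * ⟦ g ⟧ t) ([x∙y⁻¹]⁻¹∙x≡y h g) ⟩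
    x (h ∙ g ⁻¹) * ⟦ g ⟧ g
      ≡⟨ ≡.cong (x (h ∙ g ⁻¹) *_) (⟦⟧-same g) ⟩
    x (h ∙ g ⁻¹) * 1#
      ≈⟨ *-identityʳ _ ⟩
    x (h ∙ g ⁻¹)
      ∎
    where
      j = from (h ∙ g ⁻¹)
      vanish : ∀ i → i ≢ j → x (to i) * ⟦ g ⟧ (to i ⁻¹ ∙ h) ≈ 0#
      vanish i i≢j = trans (*-congˡ (reflexive (⟦⟧-other λ eq →
        i≢j (≡.trans (≡.sym (strictlyInverseʳ i)) (≡.cong from (x⁻¹∙y≡z⇒x≡y∙z⁻¹ eq)))))) (zeroʳ _)

  *R-identityʳ : ∀ x → x *R 1R ≈R x
  *R-identityʳ x h = trans (*R-⟦⟧ x ε h) (reflexive (≡.cong x (x∙ε⁻¹≡x h)))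

  *R-ΣR : ∀ {n} x (f : Fin n → R) → x *R ΣR f ≈R ΣR (λ j → x *R f j)
  *R-ΣR {n} x f h = trans (sum-cong-≋ {size} λ i → *-distribˡ-sum (x (to i)) (λ j → f j (to i ⁻¹ ∙ h)))
                           (∑-comm {size} {n} λ i j → x (to i) * f j (to i ⁻¹ ∙ h))

  ∂ : Γ → R → R
  ∂ g x h = x (h ∙ g ⁻¹) - x h

  norm : Γ → ℕ → R → R
  norm g m x h = sum {m} (λ s → x (h ∙ (g ^ suc (toℕ s)) ⁻¹))

  *R-β : ∀ x g → x *R β g ≈R ∂ g x
  *R-β x g h = begin
    (x *R (⟦ g ⟧ +R -R 1R)) h          ≈⟨ *R-distribˡ x ⟦ g ⟧ (-R 1R) h ⟩
    (x *R ⟦ g ⟧) h + (x *R -R 1R) h    ≈⟨ +-cong (*R-⟦⟧ x g h) (trans (*R-negʳ x 1R h) (-‿cong (*R-identityʳ x h))) ⟩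
    x (h ∙ g ⁻¹) - x h                 ∎

  *R-α : ∀ x g m → x *R α g m ≈R norm g m x
  *R-α x g m h = trans (*R-ΣR {m} x (λ k → ⟦ g ^ suc (toℕ k) ⟧) h) (sum-cong-≋ {m} λ s → *R-⟦⟧ x (g ^ suc (toℕ s)) h)

  ∂-cong : ∀ g {x y} → x ≈R y → ∂ g x ≈R ∂ g y
  ∂-cong g x≈y h = +-cong (x≈y _) (-‿cong (x≈y h))

  ∂-+ : ∀ g x y → ∂ g (x +R y) ≈R ∂ g x +R ∂ g y
  ∂-+ g x y h = trans (+-congˡ (sym (-‿+-comm (x h) (y h)))) (interchange _ _ _ _)

  ∂-neg : ∀ g x → ∂ g (-R x) ≈R -R ∂ g x
  ∂-neg g x h = -‿+-comm (x (h ∙ g ⁻¹)) (- x h)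

  ∂-ΣR : ∀ {n} g (f : Fin n → R) → ∂ g (ΣR f) ≈R ΣR (λ j → ∂ g (f j))
  ∂-ΣR g f h = trans (+-congˡ (sym (sum-neg (λ i → f i h))))
                     (sym (∑-distrib-+ (λ i → f i (h ∙ g ⁻¹)) (λ i → - f i h)))

  ∂-comm : ∀ a b x → ∂ a (∂ b x) ≈R ∂ b (∂ a x)
  ∂-comm a b x h = trans
    (+-congʳ (+-congʳ (reflexive (≡.cong x (xy∙z≈xz∙y h (a ⁻¹) (b ⁻¹))))))
    ([a-b]-[c-d]≈[a-c]-[b-d] _ _ _ _)

  ∂-β : ∀ a b h → ∂ a (β b) h ≈ (⟦ a ∙ b ⟧ h - ⟦ a ⟧ h) - (⟦ b ⟧ h - ⟦ ε ⟧ h)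
  ∂-β a b h = +-congʳ (+-cong (reflexive (⟦⟧-translate b a h))
    (-‿cong (reflexive (≡.trans (⟦⟧-translate ε a h) (≡.cong (λ x → ⟦ x ⟧ h) (identityʳ a))))))

  ∂-β-comm : ∀ a b → ∂ a (β b) ≈R ∂ b (β a)
  ∂-β-comm a b h = begin
    ∂ a (β b) h
      ≈⟨ ∂-β a b h ⟩
    (⟦ a ∙ b ⟧ h - ⟦ a ⟧ h) - (⟦ b ⟧ h - ⟦ ε ⟧ h)
      ≈⟨ [a-b]-[c-d]≈[a-c]-[b-d] _ _ _ _ ⟩
    (⟦ a ∙ b ⟧ h - ⟦ b ⟧ h) - (⟦ a ⟧ h - ⟦ ε ⟧ h)
      ≡⟨ ≡.cong (λ x → (⟦ x ⟧ h - ⟦ b ⟧ h) - (⟦ a ⟧ h - ⟦ ε ⟧ h)) (comm a b) ⟩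
    (⟦ b ∙ a ⟧ h - ⟦ b ⟧ h) - (⟦ a ⟧ h - ⟦ ε ⟧ h)
      ≈⟨ ∂-β b a h ⟨
    ∂ b (β a) h
      ∎

  ∂-α : ∀ γ m → γ ^ m ≡ ε → ∂ γ (α γ m) ≈R 0R
  ∂-α γ m γᵐ≡ε h = begin
    ∂ γ (α γ m) h                                    ≈⟨ ∂-ΣR {m} γ (λ k → ⟦ γ ^ suc (toℕ k) ⟧) h ⟩
    sum {m} (λ s → ⟦ γ ^ suc (toℕ s) ⟧ (h ∙ γ ⁻¹) - φ (toℕ s))
                                                     ≡⟨ sum-cong-≗ {m} (λ s → ≡.cong (_- φ (toℕ s)) (⟦⟧-translate _ γ h)) ⟩
    sum {m} (λ s → φ (suc (toℕ s)) - φ (toℕ s))      ≈⟨ sum-telescope m φ ⟩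
    φ m - φ 0                                        ≡⟨ ≡.cong (λ x → ⟦ γ ∙ x ⟧ h - φ 0) γᵐ≡ε ⟩
    φ 0 - φ 0                                        ≈⟨ -‿inverseʳ (φ 0) ⟩
    0#                                               ∎
    where
      φ : ℕ → ∣K∣
      φ n = ⟦ γ ^ suc n ⟧ h

  norm-cong : ∀ γ m {x y} → x ≈R y → norm γ m x ≈R norm γ m y
  norm-cong γ m x≈y h = sum-cong-≋ {m} λ s → x≈y _

  norm-+ : ∀ γ m x y → norm γ m (x +R y) ≈R norm γ m x +R norm γ m y
  norm-+ γ m x y h = ∑-distrib-+ {m} (λ s → x (h ∙ (γ ^ suc (toℕ s)) ⁻¹)) (λ s → y (h ∙ (γ ^ suc (toℕ s)) ⁻¹))

  norm-neg : ∀ γ m x → norm γ m (-R x) ≈R -R norm γ m x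
  norm-neg γ m x h = sum-neg {m} (λ s → x (h ∙ (γ ^ suc (toℕ s)) ⁻¹))

  norm-0 : ∀ γ m → norm γ m 0R ≈R 0R
  norm-0 γ m h = sum-zero {m} (λ _ → 0#) (λ _ → refl)

  norm-∂ : ∀ γ m g x → norm γ m (∂ g x) ≈R ∂ g (norm γ m x)
  norm-∂ γ m g x h = trans (∑-distrib-+ {m} (λ s → x (y s ∙ g ⁻¹)) (λ s → - x (y s)))
    (+-cong (reflexive (sum-cong-≗ {m} λ s → ≡.cong x (xy∙z≈xz∙y h _ (g ⁻¹)))) (sum-neg {m} (x ∘ y)))
    where
      y : Fin m → Γ
      y s = h ∙ (γ ^ suc (toℕ s)) ⁻¹

  norm-∂-self : ∀ γ m → γ ^ m ≡ ε → ∀ x → norm γ m (∂ γ x) ≈R 0R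
  norm-∂-self γ m γᵐ≡ε x h = begin
    norm γ m (∂ γ x) h
      ≡⟨ sum-cong-≗ {m} (λ s → ≡.cong (λ y → x y - φ (toℕ s)) (∙^⁻¹-suc h γ (suc (toℕ s)))) ⟩
    sum {m} (λ s → φ (suc (toℕ s)) - φ (toℕ s))      ≈⟨ sum-telescope m φ ⟩
    φ m - φ 0                                        ≡⟨ ≡.cong (λ y → x (h ∙ (γ ∙ y) ⁻¹) - φ 0) γᵐ≡ε ⟩
    φ 0 - φ 0                                        ≈⟨ -‿inverseʳ (φ 0) ⟩
    0#                                               ∎
    where
      φ : ℕ → ∣K∣
      φ n = x (h ∙ (γ ^ suc n) ⁻¹)

  module CyclicProjection {γ m} (C : CyclicCoordinate γ m) where

    -- Stated with `≡ᵇ`, which `does (_ ≟ _)` would reduce to anyway, so that `with isLast h` abstracts it.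
    isLast : Γ → Bool
    isLast h = suc (coord C h) ℕ.≡ᵇ m

    isLast-true : ∀ {h} → isLast h ≡ true → suc (coord C h) ≡ m
    isLast-true {h} eq = ℕ.≡ᵇ⇒≡ (suc (coord C h)) m (≡.subst T (≡.sym eq) _)

    isLast-false : ∀ {h} → isLast h ≡ false → suc (coord C h) < m
    isLast-false {h} eq = ℕ.≤∧≢⇒< (coord< C h) λ wrap →
      ≡.subst T eq (ℕ.≡⇒≡ᵇ (suc (coord C h)) m wrap)

    Φ : R → R
    Φ x h = if isLast h then norm γ m x h else 0#

    onLast : R → R
    onLast x h = if isLast h then x h else 0#

    -- The orbit sum of x from h up to the last slice of its γ-orbit.
    J : R → R
    J x h = sum {m ∸ coord C h} (λ s → x (h ∙ (γ ^ toℕ s) ⁻¹))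

    Φ-cong : ∀ {x y} → x ≈R y → Φ x ≈R Φ y
    Φ-cong x≈y h with isLast h
    ... | true  = norm-cong γ m x≈y h
    ... | false = refl

    Φ-+ : ∀ x y → Φ (x +R y) ≈R Φ x +R Φ y
    Φ-+ x y h with isLast h
    ... | true  = norm-+ γ m x y h
    ... | false = sym (+-identityʳ 0#)

    Φ-neg : ∀ x → Φ (-R x) ≈R -R Φ x
    Φ-neg x h with isLast h
    ... | true  = norm-neg γ m x h
    ... | false = sym -0#≈0#

    Φ-0 : Φ 0R ≈R 0R
    Φ-0 h with isLast h
    ... | true  = norm-0 γ m h
    ... | false = refl

    Φ-∂-self : ∀ x → Φ (∂ γ x) ≈R 0R
    Φ-∂-self x h with isLast h
    ... | true  = norm-∂-self γ m (period C) x h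
    ... | false = refl

    Φ-∂ : ∀ g → (∀ h → coord C (h ∙ g ⁻¹) ≡ coord C h) → ∀ x → Φ (∂ g x) ≈R ∂ g (Φ x)
    Φ-∂ g invariant x h rewrite invariant h with isLast h
    ... | true  = norm-∂ γ m g x h
    ... | false = sym (-‿inverseʳ 0#)

    private
      J-length : ∀ x h {n} → m ∸ coord C h ≡ n → J x h ≡ sum {n} (λ s → x (h ∙ (γ ^ toℕ s) ⁻¹))
      J-length x h eq = ≡.cong (λ n → sum {n} (λ s → x (h ∙ (γ ^ toℕ s) ⁻¹))) eq

      J-shift : ∀ x h n → sum {n} (λ s → x (h ∙ γ ⁻¹ ∙ (γ ^ toℕ s) ⁻¹))
                        ≡ sum {n} (λ s → x (h ∙ (γ ^ suc (toℕ s)) ⁻¹))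
      J-shift x h n = sum-cong-≗ {n} λ s → ≡.cong x (≡.trans (xy∙z≈xz∙y h (γ ⁻¹) _) (∙^⁻¹-suc h γ (toℕ s)))

      -a--b≈b-a : ∀ a b → - a - - b ≈ b - a
      -a--b≈b-a a b = trans (+-congˡ (-‿involutive b)) (+-comm (- a) b)

    decomposition : ∀ x h → x h ≈ ∂ γ (-R J x) h + Φ x h
    decomposition x h with isLast h in last?
    ... | true = begin
      x h                                      ≈⟨ x-y+y≈x N (x h) ⟨
      (x h - N) + N                            ≈⟨ +-congʳ (-a--b≈b-a N (x h)) ⟨
      (- N - - x h) + N                        ≈⟨ +-congʳ (+-cong (-‿cong N≈Jhγ⁻¹) (-‿cong (-‿cong xh≈Jh))) ⟩
      (- J x (h ∙ γ ⁻¹) - - J x h) + N         ∎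
      where
        wrap = isLast-true last?
        N = norm γ m x h
        xh≈Jh : x h ≈ J x h
        xh≈Jh = sym (trans (reflexive (J-length x h (≡.trans (≡.cong (_∸ coord C h) (≡.sym wrap)) (ℕ.m+n∸n≡m 1 (coord C h)))))
                           (trans (+-identityʳ _) (reflexive (≡.cong x (x∙ε⁻¹≡x h)))))
        N≈Jhγ⁻¹ : N ≈ J x (h ∙ γ ⁻¹)
        N≈Jhγ⁻¹ = reflexive (≡.sym (≡.trans (J-length x (h ∙ γ ⁻¹) (≡.cong (m ∸_) (coord-wrap C h wrap))) (J-shift x h m)))
    ... | false = begin
      x h                                      ≈⟨ x+y-y≈x S (x h) ⟨
      (x h + S) - S                            ≈⟨ -a--b≈b-a S (x h + S) ⟨
      - S - - (x h + S)                        ≈⟨ +-cong (-‿cong S≈Jhγ⁻¹) (-‿cong (-‿cong (sym Jh≈xh+S))) ⟩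
      - J x (h ∙ γ ⁻¹) - - J x h               ≈⟨ +-identityʳ _ ⟨
      (- J x (h ∙ γ ⁻¹) - - J x h) + 0#        ∎
      where
        step = isLast-false last?
        S = sum {m ∸ suc (coord C h)} (λ s → x (h ∙ (γ ^ suc (toℕ s)) ⁻¹))
        Jh≈xh+S : J x h ≈ x h + S
        Jh≈xh+S = trans (reflexive (J-length x h (ℕ.+-∸-assoc 1 (ℕ.<⇒≤ step)))) (+-congʳ (reflexive (≡.cong x (x∙ε⁻¹≡x h))))
        S≈Jhγ⁻¹ : S ≈ J x (h ∙ γ ⁻¹)
        S≈Jhγ⁻¹ = reflexive (≡.sym (≡.trans (J-length x (h ∙ γ ⁻¹) (≡.cong (m ∸_) (coord-step C h step)))
                                            (J-shift x h (m ∸ suc (coord C h)))))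

    private
      invariant-orbit : ∀ {F} → ∂ γ F ≈R 0R → ∀ n h → F (h ∙ (γ ^ n) ⁻¹) ≈ F h
      invariant-orbit {F} ∂F≈0 zero    h = reflexive (≡.cong F (x∙ε⁻¹≡x h))
      invariant-orbit {F} ∂F≈0 (suc n) h = begin
        F (h ∙ (γ ^ suc n) ⁻¹)       ≡⟨ ≡.cong F (∙^⁻¹-suc h γ n) ⟨
        F (h ∙ (γ ^ n) ⁻¹ ∙ γ ⁻¹)    ≈⟨ x-y≈0⇒x≈y _ _ (∂F≈0 (h ∙ (γ ^ n) ⁻¹)) ⟩
        F (h ∙ (γ ^ n) ⁻¹)           ≈⟨ invariant-orbit ∂F≈0 n h ⟩
        F h                          ∎

    norm-onLast : ∀ F → ∂ γ F ≈R 0R → norm γ m (onLast F) ≈R F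
    norm-onLast F ∂F≈0 h = begin
      norm γ m (onLast F) h
        ≈⟨ sum-cong-≋ {m} select ⟩
      sum {m} (λ s → if wraps (toℕ s) then F h else 0#)
        ≈⟨ sum-select {m} (wraps ∘ toℕ) (F h) (wraps-once m pos wraps m>0 periodic step) ⟩
      F h
        ∎
      where
        orbit : ℕ → Γ
        orbit s = h ∙ (γ ^ suc s) ⁻¹
        pos : ℕ → ℕ
        pos s = coord C (orbit s)
        wraps : ℕ → Bool
        wraps s = isLast (orbit s)

        select : ∀ s → onLast F (orbit (toℕ s)) ≈ (if wraps (toℕ s) then F h else 0#)
        select s with wraps (toℕ s)
        ... | true  = invariant-orbit ∂F≈0 (suc (toℕ s)) h
        ... | false = refl

        m>0 : 0 < m
        m>0 = ℕ.≤-<-trans z≤n (coord< C h)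

        periodic : pos m ≡ pos 0
        periodic = ≡.cong (λ y → coord C (h ∙ (γ ∙ y) ⁻¹)) (period C)

        next : ∀ s → orbit s ∙ γ ⁻¹ ≡ orbit (suc s)
        next s = ∙^⁻¹-suc h γ (suc s)

        step : ∀ s → pos (suc s) ℕ.+ (if wraps s then m else 0) ≡ suc (pos s)
        step s with wraps s in last?
        ... | true  = ≡.trans (≡.cong (ℕ._+ m) (≡.trans (≡.cong (coord C) (≡.sym (next s)))
                                                         (coord-wrap C _ (isLast-true last?))))
                              (≡.sym (isLast-true last?))
        ... | false = ≡.trans (ℕ.+-identityʳ _) (≡.trans (≡.cong (coord C) (≡.sym (next s)))
                                                         (coord-step C _ (isLast-false last?)))

  private
    coordinates-tail : ∀ {k} {g : Fin (suc k) → Γ} {o} → Coordinates g o → Coordinates (g ∘ Fin.suc) (o ∘ Fin.suc)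
    coordinates-tail C = restrict C Fin.suc Fin.suc-injective

  open CyclicProjection using (Φ; Φ-cong; Φ-+; Φ-neg; Φ-0; Φ-∂-self; Φ-∂; J; decomposition)

  Ψ : ∀ {k} {g : Fin k → Γ} {o : Fin k → ℕ} → Coordinates g o → R → R
  Ψ {zero}  C x = x
  Ψ {suc k} C x = Ψ (coordinates-tail C) (Φ (cyclic C Fin.zero) x)

  Ψ-cong : ∀ {k} {g : Fin k → Γ} {o} (C : Coordinates g o) {x y} → x ≈R y → Ψ C x ≈R Ψ C y
  Ψ-cong {zero}  C x≈y = x≈y
  Ψ-cong {suc k} C x≈y = Ψ-cong (coordinates-tail C) (Φ-cong (cyclic C Fin.zero) x≈y)

  Ψ-+ : ∀ {k} {g : Fin k → Γ} {o} (C : Coordinates g o) x y → Ψ C (x +R y) ≈R Ψ C x +R Ψ C y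
  Ψ-+ {zero}  C x y h = refl
  Ψ-+ {suc k} C x y h = trans (Ψ-cong (coordinates-tail C) (Φ-+ (cyclic C Fin.zero) x y) h) (Ψ-+ (coordinates-tail C) _ _ h)

  Ψ-neg : ∀ {k} {g : Fin k → Γ} {o} (C : Coordinates g o) x → Ψ C (-R x) ≈R -R Ψ C x
  Ψ-neg {zero}  C x h = refl
  Ψ-neg {suc k} C x h = trans (Ψ-cong (coordinates-tail C) (Φ-neg (cyclic C Fin.zero) x) h) (Ψ-neg (coordinates-tail C) _ h)

  Ψ-0 : ∀ {k} {g : Fin k → Γ} {o} (C : Coordinates g o) → Ψ C 0R ≈R 0R
  Ψ-0 {zero}  C h = refl
  Ψ-0 {suc k} C h = trans (Ψ-cong (coordinates-tail C) (Φ-0 (cyclic C Fin.zero)) h) (Ψ-0 (coordinates-tail C) h)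

  Ψ-ΣR : ∀ {k n} {g : Fin k → Γ} {o} (C : Coordinates g o) (f : Fin n → R) → Ψ C (ΣR f) ≈R ΣR (Ψ C ∘ f)
  Ψ-ΣR {n = zero}  C f = Ψ-0 C
  Ψ-ΣR {n = suc n} C f h = trans (Ψ-+ C (f Fin.zero) (ΣR (f ∘ Fin.suc)) h) (+-congˡ (Ψ-ΣR C (f ∘ Fin.suc) h))

  Ψ-∂ : ∀ {k} {g : Fin k → Γ} {o} (C : Coordinates g o) a →
        (∀ i h → coord (cyclic C i) (h ∙ a ⁻¹) ≡ coord (cyclic C i) h) → ∀ x → Ψ C (∂ a x) ≈R ∂ a (Ψ C x)
  Ψ-∂ {zero}  C a invariant x h = refl
  Ψ-∂ {suc k} C a invariant x h = trans
    (Ψ-cong (coordinates-tail C) (Φ-∂ (cyclic C Fin.zero) a (invariant Fin.zero) x) h)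
    (Ψ-∂ (coordinates-tail C) a (invariant ∘ Fin.suc) _ h)

  Ψ-∂-self : ∀ {k} {g : Fin k → Γ} {o} (C : Coordinates g o) i x → Ψ C (∂ (g i) x) ≈R 0R
  Ψ-∂-self {suc k} C Fin.zero x h =
    trans (Ψ-cong (coordinates-tail C) (Φ-∂-self (cyclic C Fin.zero) x) h) (Ψ-0 (coordinates-tail C) h)
  Ψ-∂-self {suc k} {g} C (Fin.suc i) x h = trans
    (Ψ-cong (coordinates-tail C) (Φ-∂ (cyclic C Fin.zero) (g (Fin.suc i)) (independent C Fin.zero (Fin.suc i) λ ()) x) h)
    (Ψ-∂-self (coordinates-tail C) i _ h)

  Ψ-decomposition : ∀ {k} {g : Fin k → Γ} {o} (C : Coordinates g o) x →
                    Σ (Fin k → R) λ u → x ≈R ΣR (λ i → ∂ (g i) (u i)) +R Ψ C x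
  Ψ-decomposition {zero}  C x = (λ ()) , λ h → sym (+-identityˡ (x h))
  Ψ-decomposition {suc k} {g} C x = u , x≈
    where
      C₀ = cyclic C Fin.zero
      rest = Ψ-decomposition (coordinates-tail C) (Φ C₀ x)
      u : Fin (suc k) → R
      u Fin.zero    = -R J C₀ x
      u (Fin.suc i) = proj₁ rest i
      x≈ : x ≈R ΣR (λ i → ∂ (g i) (u i)) +R Ψ C x
      x≈ h = begin
        x h                                                     ≈⟨ decomposition C₀ x h ⟩
        ∂ (g Fin.zero) (u Fin.zero) h + Φ C₀ x h                ≈⟨ +-congˡ (proj₂ rest h) ⟩
        ∂ (g Fin.zero) (u Fin.zero) h + (ΣR (λ i → ∂ (g (Fin.suc i)) (u (Fin.suc i))) h + Ψ C x h)
                                                                ≈⟨ +-assoc _ _ _ ⟨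
        ΣR (λ i → ∂ (g i) (u i)) h + Ψ C x h                    ∎

  e-same : ∀ {k} (i : Fin k) → e i i ≡ 1R
  e-same i with i Fin.≟ i
  ... | yes _  = ≡.refl
  ... | no i≢i = ⊥-elim (i≢i ≡.refl)

  e-other : ∀ {k} {i j : Fin k} → i ≢ j → e i j ≡ 0R
  e-other {i = i} {j} i≢j with i Fin.≟ j
  ... | yes i≡j = ⊥-elim (i≢j i≡j)
  ... | no _    = ≡.refl

  *R-e-same : ∀ {k} x (i : Fin k) → x *R e i i ≈R x
  *R-e-same x i h = trans (reflexive (≡.cong (λ y → (x *R y) h) (e-same i))) (*R-identityʳ x h)

  *R-e-other : ∀ {k} x (i j : Fin k) → i ≢ j → x *R e i j ≈R 0R
  *R-e-other x i j i≢j h = trans (reflexive (≡.cong (λ y → (x *R y) h) (e-other i≢j))) (*R-zeroʳ x h)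

  ΣR-*R-e : ∀ {k} x (f : Fin k → R) i → ΣR (λ l → (x *R e i l) *R f l) ≈R x *R f i
  ΣR-*R-e x f i h = trans (sum-single _ i vanish) (*R-congʳ (f i) (*R-e-same x i) h)
    where
      vanish : ∀ l → l ≢ i → ((x *R e i l) *R f l) h ≈ 0#
      vanish l l≢i = trans (*R-congʳ (f l) (*R-e-other x i l (l≢i ∘ ≡.sym)) h) (*R-zeroˡ (f l) h)

  Kernel-cong : ∀ {k} (g : Fin k → Γ) {v w} → v ≈V w → Kernel g w → Kernel g v
  Kernel-cong {k} g v≈w w∈K h = trans (sum-cong-≋ {k} λ l → *R-congʳ (β (g l)) (v≈w l) h) (w∈K h)

  Kernel⇒∂ : ∀ {k} (g : Fin k → Γ) y → Kernel g y → ΣR (λ i → ∂ (g i) (y i)) ≈R 0R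
  Kernel⇒∂ {k} g y y∈K h = trans (sum-cong-≋ {k} λ i → sym (*R-β (y i) (g i) h)) (y∈K h)

  generators⊆Kernel : ∀ {k} (g : Fin k → Γ) o → (∀ i → g i ^ o i ≡ ε) → ∀ v → Generators g o v → Kernel g v
  generators⊆Kernel {k} g o period v (inj₁ (i , v≈)) = Kernel-cong g v≈ λ h → begin
    ΣR (λ l → (α (g i) (o i) *R e i l) *R β (g l)) h    ≈⟨ ΣR-*R-e (α (g i) (o i)) (β ∘ g) i h ⟩
    (α (g i) (o i) *R β (g i)) h                        ≈⟨ *R-β (α (g i) (o i)) (g i) h ⟩
    ∂ (g i) (α (g i) (o i)) h                           ≈⟨ ∂-α (g i) (o i) (period i) h ⟩
    0#                                                  ∎
  generators⊆Kernel {k} g o period v (inj₂ (i , j , _ , v≈)) = Kernel-cong g v≈ λ h → begin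
    ΣR (λ l → ((-R β (g j)) *R e i l +R β (g i) *R e j l) *R β (g l)) h
      ≈⟨ sum-cong-≋ {k} (λ l → *R-distribʳ (β (g l)) ((-R β (g j)) *R e i l) (β (g i) *R e j l) h) ⟩
    ΣR (λ l → (((-R β (g j)) *R e i l) *R β (g l)) +R ((β (g i) *R e j l) *R β (g l))) h
      ≈⟨ ∑-distrib-+ {k} (λ l → (((-R β (g j)) *R e i l) *R β (g l)) h) (λ l → ((β (g i) *R e j l) *R β (g l)) h) ⟩
    ΣR (λ l → ((-R β (g j)) *R e i l) *R β (g l)) h + ΣR (λ l → (β (g i) *R e j l) *R β (g l)) h
      ≈⟨ +-cong (ΣR-*R-e (-R β (g j)) (β ∘ g) i h) (ΣR-*R-e (β (g i)) (β ∘ g) j h) ⟩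
    ((-R β (g j)) *R β (g i)) h + (β (g i) *R β (g j)) h
      ≈⟨ +-cong (trans (*R-negˡ (β (g j)) (β (g i)) h) (-‿cong (*R-β (β (g j)) (g i) h))) (*R-β (β (g i)) (g j) h) ⟩
    - ∂ (g i) (β (g j)) h + ∂ (g j) (β (g i)) h
      ≈⟨ +-congʳ (-‿cong (∂-β-comm (g i) (g j) h)) ⟩
    - ∂ (g j) (β (g i)) h + ∂ (g j) (β (g i)) h
      ≈⟨ -‿inverseˡ _ ⟩
    0#  ∎

  module _ {k} (S : Vecᴿ k → Set ℓ) where

    span-cong : ∀ {y y′} → y ≈V y′ → InSpan S y′ → InSpan S y
    span-cong y≈y′ (n , v , a , v∈S , y′≈) = n , v , a , v∈S , λ i h → trans (y≈y′ i h) (y′≈ i h)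

    span-generator : ∀ a v → S v → InSpan S (a ·V v)
    span-generator a v v∈S = 1 , (λ _ → v) , (λ _ → a) , (λ _ → v∈S) , λ i h → sym (+-identityʳ _)

    span-+ : ∀ {y z} → InSpan S y → InSpan S z → InSpan S (y +V z)
    span-+ {y} {z} (n , v , a , v∈S , y≈) (n′ , v′ , a′ , v′∈S , z≈) =
      n ℕ.+ n′ , v ++ v′ , a ++ a′ , ++-all S v∈S v′∈S , λ i h → begin
        y i h + z i h
          ≈⟨ +-cong (y≈ i h) (z≈ i h) ⟩
        ΣV (λ j → a j ·V v j) i h + ΣV (λ j → a′ j ·V v′ j) i h
          ≈⟨ sum-++ (λ j → (a j ·V v j) i h) (λ j → (a′ j ·V v′ j) i h) ⟨
        sum ((λ j → (a j ·V v j) i h) ++ (λ j → (a′ j ·V v′ j) i h))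
          ≡⟨ sum-cong-≗ (++-zipWith (λ c w → (c ·V w) i h) a a′ v v′) ⟨
        ΣV (λ j → (a ++ a′) j ·V (v ++ v′) j) i h
          ∎

    span-ΣV : ∀ {n} (f : Fin n → Vecᴿ k) → (∀ j → InSpan S (f j)) → InSpan S (ΣV f)
    span-ΣV {zero}  f _       = 0 , (λ ()) , (λ ()) , (λ ()) , λ i h → refl
    span-ΣV {suc n} f f∈span = span-+ (f∈span Fin.zero) (span-ΣV (f ∘ Fin.suc) (f∈span ∘ Fin.suc))

  span-lift : ∀ {k} {S′ : Vecᴿ k → Set ℓ} {S : Vecᴿ (suc k) → Set ℓ} →
              (∀ v → S′ v → S (0R ∷ v)) → ∀ {y} → InSpan S′ y → InSpan S (0R ∷ y)
  span-lift lift {y} (n , v , a , v∈S′ , y≈) = n , (λ j → 0R ∷ v j) , a , (λ j → lift (v j) (v∈S′ j)) , y≈′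
    where
      y≈′ : (0R ∷ y) ≈V ΣV (λ j → a j ·V (0R ∷ v j))
      y≈′ Fin.zero    h = sym (sum-zero {n} _ λ j → *R-zeroʳ (a j) h)
      y≈′ (Fin.suc i) h = y≈ i h

  generators-lift : ∀ {k} (g : Fin (suc k) → Γ) o v → Generators (g ∘ Fin.suc) (o ∘ Fin.suc) v → Generators g o (0R ∷ v)
  generators-lift g o v (inj₁ (i , v≈)) = inj₁ (Fin.suc i , λ where
    Fin.zero    h → sym (*R-zeroʳ (α (g (Fin.suc i)) (o (Fin.suc i))) h)
    (Fin.suc j) h → v≈ j h)
  generators-lift g o v (inj₂ (i , j , i<j , v≈)) = inj₂ (Fin.suc i , Fin.suc j , s≤s i<j , λ where
    Fin.zero    h → sym (trans (+-cong (*R-zeroʳ (-R β (g (Fin.suc j))) h) (*R-zeroʳ (β (g (Fin.suc i))) h)) (+-identityʳ 0#))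
    (Fin.suc l) h → v≈ l h)

  module KernelStep {k} {g : Fin (suc k) → Γ} {o : Fin (suc k) → ℕ} (C : Coordinates g o)
                    (y : Vecᴿ (suc k)) (cycle : ΣR (λ i → ∂ (g i) (y i)) ≈R 0R) where

    private
      0F : Fin (suc k)
      0F = Fin.zero

      C′ = coordinates-tail C
      C₀ = cyclic C Fin.zero
      g₀ = g Fin.zero
      y₀ = y Fin.zero

      tailSum : R
      tailSum = ΣR (λ i → ∂ (g (Fin.suc i)) (y (Fin.suc i)))

    F : R
    F = Ψ C′ y₀

    u : Fin k → R
    u = proj₁ (Ψ-decomposition C′ y₀)

    y₀≈ : y₀ ≈R ΣR (λ i → ∂ (g (Fin.suc i)) (u i)) +R F
    y₀≈ = proj₂ (Ψ-decomposition C′ y₀)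

    ∂₀F≈0 : ∂ g₀ F ≈R 0R
    ∂₀F≈0 h = begin
      ∂ g₀ (Ψ C′ y₀) h        ≈⟨ Ψ-∂ C′ g₀ (λ i → independent C (Fin.suc i) Fin.zero λ ()) y₀ h ⟨
      Ψ C′ (∂ g₀ y₀) h        ≈⟨ Ψ-cong C′ (λ h′ → x+y≈0⇒x≈-y (∂ g₀ y₀ h′) (tailSum h′) (cycle h′)) h ⟩
      Ψ C′ (-R tailSum) h     ≈⟨ Ψ-neg C′ tailSum h ⟩
      - Ψ C′ tailSum h        ≈⟨ -‿cong (Ψ-ΣR C′ (λ i → ∂ (g (Fin.suc i)) (y (Fin.suc i))) h) ⟩
      - ΣR (λ i → Ψ C′ (∂ (g (Fin.suc i)) (y (Fin.suc i)))) h
                              ≈⟨ -‿cong (sum-zero {k} _ λ i → Ψ-∂-self C′ i (y (Fin.suc i)) h) ⟩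
      - 0#                    ≈⟨ -0#≈0# ⟩
      0#                      ∎

    c₀ : R
    c₀ = CyclicProjection.onLast C₀ F

    c₀α₀≈F : c₀ *R α g₀ (o Fin.zero) ≈R F
    c₀α₀≈F h = trans (*R-α c₀ g₀ (o Fin.zero) h) (CyclicProjection.norm-onLast C₀ F ∂₀F≈0 h)

    y′ : Vecᴿ k
    y′ i = y (Fin.suc i) +R ∂ g₀ (u i)

    y′-cycle : ΣR (λ i → ∂ (g (Fin.suc i)) (y′ i)) ≈R 0R
    y′-cycle h = begin
      ΣR (λ i → ∂ (gᵢ i) (y′ i)) h
        ≈⟨ sum-cong-≋ {k} (λ i → trans (∂-+ (gᵢ i) (y (Fin.suc i)) (∂ g₀ (u i)) h) (+-congˡ (∂-comm (gᵢ i) g₀ (u i) h))) ⟩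
      ΣR (λ i → ∂ (gᵢ i) (y (Fin.suc i)) +R ∂ g₀ (∂ (gᵢ i) (u i))) h
        ≈⟨ ∑-distrib-+ {k} (λ i → ∂ (gᵢ i) (y (Fin.suc i)) h) (λ i → ∂ g₀ (∂ (gᵢ i) (u i)) h) ⟩
      tailSum h + ΣR (λ i → ∂ g₀ (∂ (gᵢ i) (u i))) h
        ≈⟨ +-congˡ (∂-ΣR g₀ (λ i → ∂ (gᵢ i) (u i)) h) ⟨
      tailSum h + ∂ g₀ (ΣR (λ i → ∂ (gᵢ i) (u i))) h
        ≈⟨ +-congˡ (∂-cong g₀ (λ h′ → trans (sym (x+y-y≈x (F h′) _)) (+-congʳ (sym (y₀≈ h′)))) h) ⟩
      tailSum h + ∂ g₀ (y₀ +R -R F) h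
        ≈⟨ +-congˡ (trans (∂-+ g₀ y₀ (-R F) h) (+-congˡ (trans (∂-neg g₀ F h) (trans (-‿cong (∂₀F≈0 h)) -0#≈0#)))) ⟩
      tailSum h + (∂ g₀ y₀ h + 0#)
        ≈⟨ +-congˡ (+-identityʳ _) ⟩
      tailSum h + ∂ g₀ y₀ h
        ≈⟨ +-comm _ _ ⟩
      ∂ g₀ y₀ h + tailSum h
        ≈⟨ cycle h ⟩
      0#  ∎
      where
        gᵢ : Fin k → Γ
        gᵢ i = g (Fin.suc i)

    koszul : Fin k → Vecᴿ (suc k)
    koszul i = ((-R β (g (Fin.suc i))) ·V e Fin.zero) +V (β g₀ ·V e (Fin.suc i))

    normPart koszulPart : Vecᴿ (suc k)
    normPart   = c₀ ·V (α g₀ (o Fin.zero) ·V e Fin.zero)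
    koszulPart = ΣV (λ i → (-R u i) ·V koszul i)

    private
      -a+[b+a]≈b : ∀ a b → - a + (b + a) ≈ b
      -a+[b+a]≈b a b = trans (+-comm (- a) (b + a)) (x+y-y≈x a b)

      normPart-zero : normPart Fin.zero ≈R F
      normPart-zero h = trans (*R-congˡ c₀ (*R-e-same (α g₀ (o Fin.zero)) 0F) h) (c₀α₀≈F h)

      normPart-suc : ∀ l → normPart (Fin.suc l) ≈R 0R
      normPart-suc l h = trans (*R-congˡ c₀ (*R-e-other (α g₀ (o Fin.zero)) 0F (Fin.suc l) λ ()) h) (*R-zeroʳ c₀ h)

      koszulPart-zero : koszulPart Fin.zero ≈R ΣR (λ i → ∂ (g (Fin.suc i)) (u i))
      koszulPart-zero h = sum-cong-≋ {k} λ i → begin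
        ((-R u i) *R koszul i Fin.zero) h              ≈⟨ *R-congˡ (-R u i) (koszul-zero i) h ⟩
        ((-R u i) *R (-R β (g (Fin.suc i)))) h         ≈⟨ *R-negʳ (-R u i) (β (g (Fin.suc i))) h ⟩
        - ((-R u i) *R β (g (Fin.suc i))) h            ≈⟨ -‿cong (*R-negˡ (u i) (β (g (Fin.suc i))) h) ⟩
        - - (u i *R β (g (Fin.suc i))) h               ≈⟨ -‿involutive _ ⟩
        (u i *R β (g (Fin.suc i))) h                   ≈⟨ *R-β (u i) (g (Fin.suc i)) h ⟩
        ∂ (g (Fin.suc i)) (u i) h                      ∎
        where
          koszul-zero : ∀ i → koszul i Fin.zero ≈R -R β (g (Fin.suc i))
          koszul-zero i h′ = trans (+-cong (*R-e-same (-R β (g (Fin.suc i))) 0F h′) (*R-e-other (β g₀) (Fin.suc i) 0F (λ ()) h′))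
                                 (+-identityʳ _)

      koszulPart-suc : ∀ l → koszulPart (Fin.suc l) ≈R -R ∂ g₀ (u l)
      koszulPart-suc l h = begin
        sum {k} (λ i → ((-R u i) *R koszul i (Fin.suc l)) h)   ≈⟨ sum-single _ l vanish ⟩
        ((-R u l) *R koszul l (Fin.suc l)) h               ≈⟨ *R-congˡ (-R u l) (koszul-suc-same) h ⟩
        ((-R u l) *R β g₀) h                               ≈⟨ *R-β (-R u l) g₀ h ⟩
        ∂ g₀ (-R u l) h                                    ≈⟨ ∂-neg g₀ (u l) h ⟩
        - ∂ g₀ (u l) h                                     ∎
        where
          koszul-suc : ∀ i → koszul i (Fin.suc l) ≈R β g₀ *R e i l
          koszul-suc i h′ = trans (+-congʳ (*R-e-other (-R β (g (Fin.suc i))) 0F (Fin.suc l) (λ ()) h′)) (+-identityˡ _)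
          koszul-suc-same : koszul l (Fin.suc l) ≈R β g₀
          koszul-suc-same h′ = trans (koszul-suc l h′) (*R-e-same (β g₀) l h′)
          vanish : ∀ i → i ≢ l → ((-R u i) *R koszul i (Fin.suc l)) h ≈ 0#
          vanish i i≢l = trans (*R-congˡ (-R u i) (λ h′ → trans (koszul-suc i h′) (*R-e-other (β g₀) i l i≢l h′)) h)
                               (*R-zeroʳ (-R u i) h)

    y≈ : y ≈V (normPart +V koszulPart) +V (0R ∷ y′)
    y≈ Fin.zero h = begin
      y₀ h                                                       ≈⟨ y₀≈ h ⟩
      ΣR (λ i → ∂ (g (Fin.suc i)) (u i)) h + F h                 ≈⟨ +-comm _ _ ⟩
      F h + ΣR (λ i → ∂ (g (Fin.suc i)) (u i)) h                 ≈⟨ +-cong (normPart-zero h) (koszulPart-zero h) ⟨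
      normPart Fin.zero h + koszulPart Fin.zero h                ≈⟨ +-identityʳ _ ⟨
      normPart Fin.zero h + koszulPart Fin.zero h + 0#           ∎
    y≈ (Fin.suc l) h = begin
      y (Fin.suc l) h                                            ≈⟨ -a+[b+a]≈b (∂ g₀ (u l) h) (y (Fin.suc l) h) ⟨
      - ∂ g₀ (u l) h + y′ l h                                    ≈⟨ +-congʳ (+-identityˡ _) ⟨
      0# + - ∂ g₀ (u l) h + y′ l h                               ≈⟨ +-congʳ (+-cong (normPart-suc l h) (koszulPart-suc l h)) ⟨
      normPart (Fin.suc l) h + koszulPart (Fin.suc l) h + y′ l h ∎

  kernel-spanned : ∀ {k} {g : Fin k → Γ} {o : Fin k → ℕ} → Coordinates g o →
                   ∀ y → ΣR (λ i → ∂ (g i) (y i)) ≈R 0R → InSpan (Generators g o) y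
  kernel-spanned {zero}          C y _     = 0 , (λ ()) , (λ ()) , (λ ()) , λ ()
  kernel-spanned {suc k} {g} {o} C y cycle = span-cong (Generators g o) y≈
    (span-+ (Generators g o)
      (span-+ (Generators g o)
        (span-generator (Generators g o) c₀ _ (inj₁ (Fin.zero , λ _ _ → refl)))
        (span-ΣV (Generators g o) _ λ i →
          span-generator (Generators g o) (-R u i) (koszul i) (inj₂ (Fin.zero , Fin.suc i , s≤s z≤n , λ _ _ → refl))))
      (span-lift {S = Generators g o} (generators-lift g o) (kernel-spanned (coordinates-tail C) y′ y′-cycle)))
    where open KernelStep C y cycle

  kernel-generatedBy : ∀ {k} {g : Fin k → Γ} {o : Fin k → ℕ} → Coordinates g o → GeneratedBy (Kernel g) (Generators g o)
  kernel-generatedBy {g = g} {o} C =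
    generators⊆Kernel g o (λ i → period (cyclic C i)) , λ y y∈K → kernel-spanned C y (Kernel⇒∂ g y y∈K)

-- ℤₚ[G] as a group algebra

-- The algebra sees ℤₚ only through opaque copies of its operations, and Defs.GroupRing is used
-- without a module alias: either way Agda would otherwise compare unfolded ℤₚ expressions together
-- with their coherence proofs, which is prohibitively slow.
module ℤₚGroupRing (p : ℕ) (G : FinAbGroup) where
  open FinAbGroup G using (Carrier; _∙_; _⁻¹; ε)
  open GroupNotions G using (_^_)
  open Inverse (FinAbGroup.enum G) using (to; from)
  open ≡ using (refl; sym; cong₂; subst₂)

  opaque
    _+′_ _*′_ : ℤₚ p → ℤₚ p → ℤₚ p
    _+′_ = _+ₚ_
    _*′_ = _*ₚ_

    -′_ : ℤₚ p → ℤₚ p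
    -′_ = -ₚ_

    0′ 1′ : ℤₚ p
    0′ = 0ₚ
    1′ = 1ₚ

  opaque
    unfolding _+′_

    +≡ : ∀ a a′ b b′ → a ≡ a′ → b ≡ b′ → a +ₚ b ≡ a′ +′ b′
    +≡ a a′ b b′ refl refl = refl

    *≡ : ∀ a a′ b b′ → a ≡ a′ → b ≡ b′ → a *ₚ b ≡ a′ *′ b′
    *≡ a a′ b b′ refl refl = refl

    -≡ : ∀ a a′ → a ≡ a′ → -ₚ a ≡ -′ a′
    -≡ a a′ refl = refl

    0ₚ≡0′ : 0ₚ ≡ 0′
    0ₚ≡0′ = refl

    1ₚ≡1′ : 1ₚ ≡ 1′
    1ₚ≡1′ = refl

    isCommutativeRing′ : IsCommutativeRing (_≈ₚ_ {p}) _+′_ _*′_ -′_ 0′ 1′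
    isCommutativeRing′ = ℤₚ-isCommutativeRing

  ℤₚ-ring′ : CommutativeRing 0ℓ 0ℓ
  ℤₚ-ring′ = record { isCommutativeRing = isCommutativeRing′ }

  module Alg = GroupAlgebra ℤₚ-ring′ G

  private
    R : Set
    R = Carrier → ℤₚ p

    Σℤₚ≡sum : ∀ {n} (f f′ : Fin n → ℤₚ p) → (∀ i → f i ≡ f′ i) →
              GroupRing.Σℤₚ p G f ≡ Vector.foldr _+′_ 0′ f′
    Σℤₚ≡sum {zero}  f f′ f≡f′ = 0ₚ≡0′
    Σℤₚ≡sum {suc n} f f′ f≡f′ = +≡ (f Fin.zero) (f′ Fin.zero) _ _ (f≡f′ Fin.zero)
      (Σℤₚ≡sum (f ∘ Fin.suc) (f′ ∘ Fin.suc) (f≡f′ ∘ Fin.suc))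

    *R≡ : ∀ x x′ y y′ → (∀ h → x h ≡ x′ h) → (∀ h → y h ≡ y′ h) →
          ∀ h → GroupRing._*R_ p G x y h ≡ (x′ Alg.*R y′) h
    *R≡ x x′ y y′ x≡x′ y≡y′ h =
      Σℤₚ≡sum (λ i → x (to i) *ₚ y (to i ⁻¹ ∙ h)) (λ i → x′ (to i) *′ y′ (to i ⁻¹ ∙ h))
      (λ i → *≡ (x (to i)) (x′ (to i)) (y (to i ⁻¹ ∙ h)) (y′ (to i ⁻¹ ∙ h)) (x≡x′ (to i)) (y≡y′ (to i ⁻¹ ∙ h)))

    ΣR≡ : ∀ {n} (F F′ : Fin n → R) → (∀ i h → F i h ≡ F′ i h) → ∀ h → GroupRing.ΣR p G F h ≡ Alg.ΣR F′ h
    ΣR≡ {zero}  F F′ F≡F′ h = 0ₚ≡0′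
    ΣR≡ {suc n} F F′ F≡F′ h = +≡ (F Fin.zero h) (F′ Fin.zero h) (GroupRing.ΣR p G (F ∘ Fin.suc) h) (Alg.ΣR (F′ ∘ Fin.suc) h)
      (F≡F′ Fin.zero h) (ΣR≡ (F ∘ Fin.suc) (F′ ∘ Fin.suc) (F≡F′ ∘ Fin.suc) h)

    ΣV≡ : ∀ {k n} (F F′ : Fin n → Fin k → R) → (∀ j i h → F j i h ≡ F′ j i h) →
          ∀ i h → GroupRing.ΣV p G F i h ≡ Alg.ΣV F′ i h
    ΣV≡ {n = zero}  F F′ F≡F′ i h = 0ₚ≡0′
    ΣV≡ {n = suc n} F F′ F≡F′ i h =
      +≡ (F Fin.zero i h) (F′ Fin.zero i h) (GroupRing.ΣV p G (F ∘ Fin.suc) i h) (Alg.ΣV (F′ ∘ Fin.suc) i h)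
         (F≡F′ Fin.zero i h) (ΣV≡ (F ∘ Fin.suc) (F′ ∘ Fin.suc) (F≡F′ ∘ Fin.suc) i h)

    ⟦⟧≡ : ∀ g h → GroupRing.⟦_⟧ p G g h ≡ Alg.⟦ g ⟧ h
    ⟦⟧≡ g h = cong₂ (λ a b → if does (from h Fin.≟ from g) then a else b) 1ₚ≡1′ 0ₚ≡0′

    β≡ : ∀ g h → GroupRing.β p G g h ≡ Alg.β g h
    β≡ g h = +≡ (GroupRing.⟦_⟧ p G g h) (Alg.⟦ g ⟧ h) (-ₚ GroupRing.⟦_⟧ p G ε h) (-′ Alg.⟦ ε ⟧ h)
               (⟦⟧≡ g h) (-≡ (GroupRing.⟦_⟧ p G ε h) (Alg.⟦ ε ⟧ h) (⟦⟧≡ ε h))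

    -β≡ : ∀ g h → GroupRing.-R_ p G (GroupRing.β p G g) h ≡ (Alg.-R Alg.β g) h
    -β≡ g h = -≡ (GroupRing.β p G g h) (Alg.β g h) (β≡ g h)

    α≡ : ∀ g m h → GroupRing.α p G g m h ≡ Alg.α g m h
    α≡ g m = ΣR≡ {m} (λ k → GroupRing.⟦_⟧ p G (g ^ suc (toℕ k))) (λ k → Alg.⟦ g ^ suc (toℕ k) ⟧)
                     (λ k → ⟦⟧≡ (g ^ suc (toℕ k)))

    e≡ : ∀ {k} (i l : Fin k) h → GroupRing.e p G i l h ≡ Alg.e i l h
    e≡ i l h with i Fin.≟ l
    ... | yes _ = ⟦⟧≡ ε h
    ... | no _  = 0ₚ≡0′

    module _ {k} (g : Fin k → Carrier) where

      kernel≡ : ∀ (y : Fin k → R) h →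
                GroupRing.ΣR p G (λ i → GroupRing._*R_ p G (y i) (GroupRing.β p G (g i))) h
                  ≡ Alg.ΣR (λ i → y i Alg.*R Alg.β (g i)) h
      kernel≡ y = ΣR≡ (λ i → GroupRing._*R_ p G (y i) (GroupRing.β p G (g i))) (λ i → y i Alg.*R Alg.β (g i))
                      (λ i → *R≡ (y i) (y i) (GroupRing.β p G (g i)) (Alg.β (g i)) (λ _ → refl) (β≡ (g i)))

      Kernel→ : ∀ (y : Fin k → R) → GroupRing.Kernel p G g y → Alg.Kernel g y
      Kernel→ y y∈K h = subst₂ _≈ₚ_ (kernel≡ y h) 0ₚ≡0′ (y∈K h)

      Kernel← : ∀ (y : Fin k → R) → Alg.Kernel g y → GroupRing.Kernel p G g y
      Kernel← y y∈K h = subst₂ _≈ₚ_ (sym (kernel≡ y h)) (sym 0ₚ≡0′) (y∈K h)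

      module _ (m : Fin k → ℕ) where
        private
          αe≡ : ∀ i l h → GroupRing._*R_ p G (GroupRing.α p G (g i) (m i)) (GroupRing.e p G i l) h
                          ≡ (Alg.α (g i) (m i) Alg.*R Alg.e i l) h
          αe≡ i l = *R≡ (GroupRing.α p G (g i) (m i)) (Alg.α (g i) (m i)) (GroupRing.e p G i l) (Alg.e i l)
                        (α≡ (g i) (m i)) (e≡ i l)

          koszul≡ : ∀ i j l h →
            GroupRing._*R_ p G (GroupRing.-R_ p G (GroupRing.β p G (g j))) (GroupRing.e p G i l) h
              +ₚ GroupRing._*R_ p G (GroupRing.β p G (g i)) (GroupRing.e p G j l) h
            ≡ ((Alg.-R Alg.β (g j)) Alg.*R Alg.e i l) h +′ (Alg.β (g i) Alg.*R Alg.e j l) h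
          koszul≡ i j l h = +≡
            (GroupRing._*R_ p G (GroupRing.-R_ p G (GroupRing.β p G (g j))) (GroupRing.e p G i l) h)
            (((Alg.-R Alg.β (g j)) Alg.*R Alg.e i l) h)
            (GroupRing._*R_ p G (GroupRing.β p G (g i)) (GroupRing.e p G j l) h)
            ((Alg.β (g i) Alg.*R Alg.e j l) h)
            (*R≡ (GroupRing.-R_ p G (GroupRing.β p G (g j))) (Alg.-R Alg.β (g j)) (GroupRing.e p G i l) (Alg.e i l)
                 (-β≡ (g j)) (e≡ i l) h)
            (*R≡ (GroupRing.β p G (g i)) (Alg.β (g i)) (GroupRing.e p G j l) (Alg.e j l) (β≡ (g i)) (e≡ j l) h)

        Generators→ : ∀ (v : Fin k → R) → GroupRing.Generators p G g m v → Alg.Generators g m v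
        Generators→ v (inj₁ (i , v≈)) = inj₁ (i , λ l h → ≡.subst (v l h ≈ₚ_) (αe≡ i l h) (v≈ l h))
        Generators→ v (inj₂ (i , j , i<j , v≈)) =
          inj₂ (i , j , i<j , λ l h → ≡.subst (v l h ≈ₚ_) (koszul≡ i j l h) (v≈ l h))

        Generators← : ∀ (v : Fin k → R) → Alg.Generators g m v → GroupRing.Generators p G g m v
        Generators← v (inj₁ (i , v≈)) = inj₁ (i , λ l h → ≡.subst (v l h ≈ₚ_) (sym (αe≡ i l h)) (v≈ l h))
        Generators← v (inj₂ (i , j , i<j , v≈)) =
          inj₂ (i , j , i<j , λ l h → ≡.subst (v l h ≈ₚ_) (sym (koszul≡ i j l h)) (v≈ l h))

        InSpan← : ∀ (y : Fin k → R) → Alg.InSpan (Alg.Generators g m) y → GroupRing.InSpan p G (GroupRing.Generators p G g m) y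
        InSpan← y (n , v , a , v∈S , y≈) = n , v , a , (λ j → Generators← (v j) (v∈S j)) , λ i h →
          ≡.subst (y i h ≈ₚ_) (sym (ΣV≡ (λ j → GroupRing._·V_ p G (a j) (v j)) (λ j → a j Alg.·V v j)
                                         (λ j l → *R≡ (a j) (a j) (v j l) (v j l) (λ _ → refl) (λ _ → refl)) i h))
                  (y≈ i h)

  transfer-generatedBy : ∀ {k} (g : Fin k → Carrier) m →
                 Alg.GeneratedBy (Alg.Kernel g) (Alg.Generators g m) →
                 GroupRing.GeneratedBy p G (GroupRing.Kernel p G g) (GroupRing.Generators p G g m)
  transfer-generatedBy g m (sound , complete) =
    (λ v v∈S → Kernel← g v (sound v (Generators→ g m v v∈S))) ,
    (λ y y∈K → InSpan← g m y (complete y (Kernel→ g y y∈K)))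

propositionA2 :
    (p : ℕ) → Prime p → (G : FinAbGroup) →
    let open FinAbGroup G
        open GroupNotions G
        open GroupRing p G
    in (r : ℕ) (g : Fin r → Carrier) (ord : Fin r → ℕ) →
       (∀ i → IsOrder (g i) (ord i)) →
       IsInternalDirectProduct g →
       (k : ℕ) → 1 ≤ k → (k≤r : k ≤ r) →
       GeneratedBy (Kernel (λ i → g (inject≤ i k≤r)))
                   (Generators (λ i → g (inject≤ i k≤r)) (λ i → ord (inject≤ i k≤r)))
propositionA2 p _ G r g ord order direct k _ k≤r =
  transfer-generatedBy (λ i → g (inject≤ i k≤r)) (λ i → ord (inject≤ i k≤r))
    (Alg.kernel-generatedBy (restrict (directProductCoordinates order direct) (λ i → inject≤ i k≤r)
                                    (Fin.inject≤-injective k≤r k≤r _ _)))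
  where
    open ℤₚGroupRing p G using (module Alg; transfer-generatedBy)
    open DirectProductCoordinates G using (restrict; directProductCoordinates)
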